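{- For every $n\geqslant 1$, the poset $(S_n,\leqslant)$, where $\leqslant$ is the (strong) Bruhat order, is isomorphic to the poset $\mathcal{PC}_n=(\mathcal{C}_n,\leqslant_A)$.
   Context: $S_n$ is the symmetric group generated by simple transpositions $s_i=(i,i+1)$, $i\in[n-1]$, with length $\ell$. The (strong) Bruhat order: $u\leqslant w$ if, for a reduced decomposition $w=s_{j_1}\cdots s_{j_r}$, $u$ equals the product of a subword $s_{j_{i_1}}\cdots s_{j_{i_k}}$ with $i_1<\dots<i_k$. A (weak) composition is a finite sequence $\alpha=(\alpha_1,\dots,\alpha_m)$ of nonnegative integers, with $\alpha_k=0$ for $k>m$; $|\alpha|=\sum_k\alpha_k$. $\mathcal{C}_n$ is the set of compositions $(\alpha_1,\dots,\alpha_{n-1})$ with $0\leqslant\alpha_i\leqslant n-i$ for all $i$ (it is in bijection with $S_n$ via the Lehmer code $w\mapsto(\#\{k>i:w(k)<w(i)\})_{i=1}^{n-1}$). For a composition $\alpha$, a positive integer $i$ and $j\in\mathbb{N}$, define $c_{i,j}(\alpha)$ recursively: $c_{i,j}(\alpha)=0$ if $j\leqslant i+1$; for $j>i+1$, $c_{i,j}(\alpha)=c_{i,j-1}(\alpha)+1$ if $\alpha_{j-1}<\alpha_i-c_{i,j-1}(\alpha)$ and $c_{i,j}(\alpha)=c_{i,j-1}(\alpha)$ otherwise. Given compositions with $|\alpha|=|\alpha'|+1$, $\alpha$ covers $\alpha'$ if there exist positive integers $i<j$ with: (a1) $\alpha'_i\leqslant\alpha_i-1$; (a2) $\alpha'_j=\alpha_j+\alpha_i-\alpha'_i-1$;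 (a3) $\alpha'_k=\alpha_k$ for all $k\neq i,j$; (a4) $c_{i,j}(\alpha)=c_{i,j}(\alpha')=\alpha'_i-\alpha_j$. The order $\leqslant_A$ on $\mathcal{C}_n$ is the reflexive-transitive closure of this covering relation restricted to $\mathcal{C}_n$: $\beta\leqslant_A\alpha$ iff there is a chain $\beta=\gamma_0,\gamma_1,\dots,\gamma_r=\alpha$ in $\mathcal{C}_n$ with $\gamma_{t+1}$ covering $\gamma_t$ for each $t$. -}

module Defs where

open import Data.Nat using (ℕ; zero; suc; _+_; _∸_; _≤_; _<_; _≤ᵇ_; _<ᵇ_; pred)
open import Data.Nat.Properties using ()
open import Data.Bool using (if_then_else_)
open import Data.List using (List; []; _∷_; length)
open import Data.Nat.ListAction using (sum)
open import Data.Fin using (Fin; inject₁) renaming (suc to fsuc)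
open import Data.Fin.Permutation using (Permutation′; transpose; _∘ₚ_; _≈_) renaming (id to idₚ)
open import Data.List.Relation.Binary.Sublist.Propositional using (_⊆_)
open import Data.Product using (Σ; ∃; ∃-syntax; _×_)
open import Relation.Binary.PropositionalEquality using (_≡_; _≢_)
open import Relation.Binary.Construct.Closure.ReflexiveTransitive using (Star)

-- Symmetric group S_n with n = suc m, as permutations of Fin (suc m),
-- with (extensional) equality _≈_ from Data.Fin.Permutation.

-- simple transposition s_i = (i, i+1), i ∈ [n-1]; here i : Fin m is
-- 0-indexed, so it swaps positions i and i+1 of Fin (suc m).
s : ∀ {m} → Fin m → Permutation′ (suc m)
s i = transpose (inject₁ i) (fsuc i)

prod : ∀ {m} → List (Fin m) → Permutation′ (suc m)
prod []      = idₚ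
prod (i ∷ w) = prod w ∘ₚ s i   -- as functions: s_i after (prod w)

IsReduced : ∀ {m} → List (Fin m) → Permutation′ (suc m) → Set
IsReduced {m} w π = (prod w ≈ π) × (∀ (v : List (Fin m)) → prod v ≈ π → length w ≤ length v)

_≤B_ : ∀ {m} → Permutation′ (suc m) → Permutation′ (suc m) → Set
_≤B_ {m} u w = ∃[ r ] (IsReduced r w × ∃[ v ] (v ⊆ r × prod v ≈ u))

-- Compositions: finite lists of naturals, α_k = 0 beyond the list.

get : List ℕ → ℕ → ℕ
get []       _       = 0
get (x ∷ xs) zero    = x
get (x ∷ xs) (suc k) = get xs k

-- 1-indexed entry α_k (k positive)
_‼_ : List ℕ → ℕ → ℕ
α ‼ k = get α (pred k)

c : List ℕ → ℕ → ℕ → ℕ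
c α i zero    = 0
c α i (suc j) =
  if suc j ≤ᵇ suc i then 0
  else (if (α ‼ j) <ᵇ ((α ‼ i) ∸ c α i j) then suc (c α i j) else c α i j)

Covers : List ℕ → List ℕ → Set
Covers α α' =
  (sum α ≡ sum α' + 1) ×
  ∃[ i ] ∃[ j ] ((1 ≤ i) × (i < j) ×
    (suc (α' ‼ i) ≤ α ‼ i) ×
    (α' ‼ j ≡ ((α ‼ j) + (α ‼ i)) ∸ (α' ‼ i) ∸ 1) ×
    (∀ k → 1 ≤ k → k ≢ i → k ≢ j → α' ‼ k ≡ α ‼ k) ×
    (c α i j ≡ c α' i j) × (c α' i j + (α ‼ j) ≡ α' ‼ i))

InC : ℕ → List ℕ → Set
InC m α = (length α ≡ m) × (∀ i → 1 ≤ i → i ≤ m → α ‼ i ≤ suc m ∸ i)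

CoverStep : ℕ → List ℕ → List ℕ → Set
CoverStep m β γ = InC m β × InC m γ × Covers γ β

_≤A[_]_ : List ℕ → ℕ → List ℕ → Set
β ≤A[ m ] α = InC m β × InC m α × Star (CoverStep m) β α

-- A permutation π of {0, …, m} is encoded by the list of values of π⁻¹ and then by the Lehmer
-- code of that list (the number of later, smaller entries at each position) with its last entry,
-- always 0, dropped. Lehmer codes of such lists are exactly the compositions in C_n.
--
-- The covers of ≤_A are the images of the Bruhat covers of these lists: values x < y at two
-- positions are exchanged, and no entry in between has a value in (x, y). The statistic c_{i,j}
-- counts the entries between the two positions that lie below the value at position i, so (a4)
-- compares these counts for y and for x; it holds exactly when no entry in between lies in (x, y).
--
-- For the subword description of the Bruhat order: the product of a subword of a reduced word
-- lies below it in the rank criterion, two lists comparable in the rank criterion are joined by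
-- a chain of covers, and a cover below the product of a word is the product of that word with
-- one letter deleted.
module Submission where

open import Defs
open import Data.Bool using (true; false; if_then_else_; T)
open import Data.Empty using (⊥; ⊥-elim)
open import Data.Fin using (Fin; toℕ; fromℕ<; inject₁) renaming (zero to fzero; suc to fsuc)
import Data.Fin.Properties as Fin
open import Data.Fin.Properties using (toℕ<n; toℕ-injective; toℕ-fromℕ<)
open import Data.Fin.Permutation using (Permutation′; _⟨$⟩ʳ_; _⟨$⟩ˡ_; inverseˡ; inverseʳ; _≈_)
import Data.Fin.Permutation.Components as PC
open import Data.List using (List; []; _∷_; length; _++_; take; drop; map; tabulate)
open import Data.List.Properties
  using (length-++; length-take; length-drop; length-tabulate; tabulate-cong; take++drop≡id; take-all; drop-all; map-++; ∷-injective)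
open import Data.List.Membership.Propositional using (_∈_; _∉_)
open import Data.List.Membership.Propositional.Properties using (∈-++⁺ˡ; ∈-++⁺ʳ; ∈-++⁻)
open import Data.List.Relation.Unary.All as All using (All; []; _∷_)
open import Data.List.Relation.Unary.All.Properties using (take⁺; tabulate⁺; All¬⇒¬Any)
open import Data.List.Relation.Unary.AllPairs as AllPairs using ([]; _∷_)
open import Data.List.Relation.Unary.Any using (here; there)
open import Data.List.Relation.Unary.Unique.Propositional using (Unique)
open import Data.List.Relation.Unary.Unique.Propositional.Properties using (Unique[x∷xs]⇒x∉xs)
import Data.List.Relation.Unary.Unique.Propositional.Properties as UniqueProps
open import Data.List.Relation.Binary.Permutation.Propositional
  using (_↭_; ↭-sym; ↭⇒↭ₛ) renaming (refl to ↭-refl; prep to ↭-prep; swap to ↭-swap; trans to ↭-trans)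
open import Data.List.Relation.Binary.Permutation.Propositional.Properties using (∈-resp-↭; drop-∷; All-resp-↭; ↭-length; shift; ++⁺ˡ)
import Data.List.Relation.Binary.Permutation.Setoid.Properties as PermProps
open import Data.List.Relation.Binary.Sublist.Propositional using (_⊆_; []; _∷_; _∷ʳ_; ⊆-refl; ⊆-trans)
open import Data.Nat using (ℕ; zero; suc; _+_; _∸_; _≤_; _<_; _≤ᵇ_; _<ᵇ_; pred; z≤n; s≤s; _<?_; _≤?_)
open import Data.Nat.Properties
open import Data.Nat.ListAction using (sum)
open import Data.Nat.ListAction.Properties using (sum-++)
open import Data.Nat.Solver using (module +-*-Solver)
open import Data.List.Membership.DecPropositional _≟_ using (_∈?_)
open import Data.Product using (Σ; ∃-syntax; _×_; _,_; proj₁; proj₂)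
open import Data.Sum using (_⊎_; inj₁; inj₂)
open import Data.Unit using (⊤; tt)
open import Function.Bundles using (_⇔_; mk⇔)
open import Relation.Binary.Construct.Closure.ReflexiveTransitive using (Star; ε; _◅_)
open import Relation.Binary.Definitions using (tri<; tri≈; tri>)
open import Relation.Binary.PropositionalEquality
  using (_≡_; _≢_; refl; sym; trans; cong; cong₂; subst; subst₂; setoid; module ≡-Reasoning)
open import Relation.Nullary using (¬_; yes; no; Dec; does)

open +-*-Solver using (solve; _:+_; _:=_; con)


-- Counting entries below a bound

-- The indicator of x < v. It is abstract so that terms below x v stay intact under `with`
-- and are only ever rewritten through below-< and below-≥.
abstract
  below : ℕ → ℕ → ℕ
  below x v with x <? v
  ... | yes _ = 1
  ... | no _ = 0

  below-< : ∀ {x v} → x < v → below x v ≡ 1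
  below-< {x} {v} p with x <? v
  ... | yes _ = refl
  ... | no q = ⊥-elim (q p)

  below-≥ : ∀ {x v} → v ≤ x → below x v ≡ 0
  below-≥ {x} {v} p with x <? v
  ... | yes q = ⊥-elim (<⇒≱ q p)
  ... | no _ = refl

below-cases : ∀ x v → (x < v × below x v ≡ 1) ⊎ (v ≤ x × below x v ≡ 0)
below-cases x v with x <? v
... | yes p = inj₁ (p , below-< p)
... | no p = inj₂ (≮⇒≥ p , below-≥ (≮⇒≥ p))

below≤1 : ∀ x v → below x v ≤ 1
below≤1 x v with below-cases x v
... | inj₁ (_ , e) = ≤-reflexive e
... | inj₂ (_ , e) = subst (_≤ 1) (sym e) z≤n

below-monoʳ : ∀ x {v w} → v ≤ w → below x v ≤ below x w
below-monoʳ x {v} {w} v≤w with below-cases x v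
... | inj₁ (x<v , e) = ≤-reflexive (trans e (sym (below-< (<-≤-trans x<v v≤w))))
... | inj₂ (_ , e) = subst (_≤ below x w) (sym e) z≤n

#below : ℕ → List ℕ → ℕ
#below v [] = 0
#below v (x ∷ xs) = below x v + #below v xs

#below-++ : ∀ v xs ys → #below v (xs ++ ys) ≡ #below v xs + #below v ys
#below-++ v [] ys = refl
#below-++ v (x ∷ xs) ys rewrite #below-++ v xs ys = sym (+-assoc (below x v) _ _)

#below-mono : ∀ xs {v w} → v ≤ w → #below v xs ≤ #below w xs
#below-mono [] le = z≤n
#below-mono (x ∷ xs) le = +-mono-≤ (below-monoʳ x le) (#below-mono xs le)

#below≤length : ∀ v xs → #below v xs ≤ length xs
#below≤length v [] = z≤n
#below≤length v (x ∷ xs) = +-mono-≤ (below≤1 x v) (#below≤length v xs)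

#below-zero : ∀ xs → #below 0 xs ≡ 0
#below-zero [] = refl
#below-zero (x ∷ xs) rewrite below-≥ {x} {0} z≤n = #below-zero xs

#below-take-drop : ∀ V t Z → #below V Z ≡ #below V (take t Z) + #below V (drop t Z)
#below-take-drop V t Z = trans (cong (#below V) (sym (take++drop≡id t Z))) (#below-++ V (take t Z) (drop t Z))

#below-resp-↭ : ∀ v {xs ys} → xs ↭ ys → #below v xs ≡ #below v ys
#below-resp-↭ v ↭-refl = refl
#below-resp-↭ v (↭-prep x p) = cong (below x v +_) (#below-resp-↭ v p)
#below-resp-↭ v (↭-swap {xs} {ys} x y p) rewrite #below-resp-↭ v p =
  solve 3 (λ a b c → a :+ (b :+ c) := b :+ (a :+ c)) refl (below x v) (below y v) (#below v ys)
#below-resp-↭ v (↭-trans p q) = trans (#below-resp-↭ v p) (#below-resp-↭ v q)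

#below-swap : ∀ v y B x C → #below v (y ∷ B ++ x ∷ C) ≡ #below v (x ∷ B ++ y ∷ C)
#below-swap v y B x C rewrite #below-++ v B (x ∷ C) | #below-++ v B (y ∷ C) =
  solve 4 (λ a b p q → a :+ (p :+ (b :+ q)) := b :+ (p :+ (a :+ q))) refl (below y v) (below x v) (#below v B) (#below v C)

#below-cong : ∀ {u w} xs → All (λ b → below b u ≡ below b w) xs → #below u xs ≡ #below w xs
#below-cong [] [] = refl
#below-cong (x ∷ xs) (e ∷ es) = cong₂ _+_ e (#below-cong xs es)

≤all⇒#below≡0 : ∀ {v xs} → All (v ≤_) xs → #below v xs ≡ 0
≤all⇒#below≡0 [] = refl
≤all⇒#below≡0 {v} {x ∷ xs} (p ∷ ps) rewrite below-≥ {x} {v} p = ≤all⇒#below≡0 ps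

#below≡0⇒≤all : ∀ {v} xs → #below v xs ≡ 0 → All (v ≤_) xs
#below≡0⇒≤all [] _ = []
#below≡0⇒≤all {v} (x ∷ xs) e with below-cases x v
... | inj₁ (_ , e1) = ⊥-elim (0≢1+n (sym (trans (cong (_+ #below v xs) (sym e1)) e)))
... | inj₂ (q , e1) = q ∷ #below≡0⇒≤all xs (trans (sym (cong (_+ #below v xs) e1)) e)

below-suc-≢ : ∀ z V → z ≢ V → below z (suc V) ≡ below z V
below-suc-≢ z V ne with below-cases z (suc V) | below-cases z V
... | inj₁ (p , e1) | inj₁ (q , e2) = trans e1 (sym e2)
... | inj₁ (p , e1) | inj₂ (q , e2) = ⊥-elim (ne (≤-antisym (≤-pred p) q))
... | inj₂ (p , e1) | inj₁ (q , e2) = ⊥-elim (<⇒≱ q (≤-trans (n≤1+n V) p))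
... | inj₂ (p , e1) | inj₂ (q , e2) = trans e1 (sym e2)

#below-suc-∉ : ∀ V Z → All (V ≢_) Z → #below (suc V) Z ≡ #below V Z
#below-suc-∉ V [] [] = refl
#below-suc-∉ V (z ∷ Z) (V≢z ∷ V∉Z) = cong₂ _+_ (below-suc-≢ z V (λ e → V≢z (sym e))) (#below-suc-∉ V Z V∉Z)

#below-suc≤ : ∀ V Z → Unique Z → #below (suc V) Z ≤ suc (#below V Z)
#below-suc≤ V [] _ = z≤n
#below-suc≤ V (z ∷ Z) (nz ∷ d) with z ≟ V
... | yes refl rewrite #below-suc-∉ z Z nz = ≤-trans (+-monoˡ-≤ (#below z Z) (below≤1 z (suc z))) (s≤s (m≤n+m _ _))
... | no ne rewrite below-suc-≢ z V ne =
  subst (below z V + #below (suc V) Z ≤_) (+-suc (below z V) (#below V Z)) (+-monoʳ-≤ (below z V) (#below-suc≤ V Z d))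

+-equal-≤-≤⇒≡ˡ : ∀ {a b c d} → a ≤ b → c ≤ d → a + c ≡ b + d → a ≡ b
+-equal-≤-≤⇒≡ˡ {a} {b} {c} {d} ab cd e with m≤n⇒m<n∨m≡n ab
... | inj₂ q = q
... | inj₁ q = ⊥-elim (<-irrefl e (+-mono-<-≤ q cd))

#below-equal⇒gap : ∀ B u w → u ≤ w → #below u B ≡ #below w B → All (λ b → b < u ⊎ w ≤ b) B
#below-equal⇒gap [] u w uw e = []
#below-equal⇒gap (b ∷ B) u w uw e = hd ∷ #below-equal⇒gap B u w uw (+-cancelˡ-≡ (below b u) _ _ (trans e (cong (_+ #below w B) (sym ie))))
  where
  ie : below b u ≡ below b w
  ie = +-equal-≤-≤⇒≡ˡ (below-monoʳ b uw) (#below-mono B uw) e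
  hd : b < u ⊎ w ≤ b
  hd with below-cases b u | below-cases b w
  ... | inj₁ (p , _) | _ = inj₁ p
  ... | inj₂ (p , _) | inj₂ (q , _) = inj₂ q
  ... | inj₂ (p , e1) | inj₁ (q , e2) = ⊥-elim (0≢1+n (trans (sym e1) (trans ie e2)))

discrete-ivt : ∀ (f : ℕ → ℕ) → f 0 ≡ 0 → (∀ V → f (suc V) ≤ suc (f V)) → ∀ n X → X ≤ f n → ∃[ V ] (f V ≡ X)
discrete-ivt f f0 fs zero X le = 0 , trans f0 (sym (n≤0⇒n≡0 (subst (X ≤_) f0 le)))
discrete-ivt f f0 fs (suc n) X le with X ≤? f n
... | yes p = discrete-ivt f f0 fs n X p
... | no p = suc n , ≤-antisym (≤-trans (fs n) (≰⇒> p)) le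


-- Positions in lists

get-++ʳ : ∀ Xs R t → get (Xs ++ R) (length Xs + t) ≡ get R t
get-++ʳ [] R t = refl
get-++ʳ (x ∷ Xs) R t = get-++ʳ Xs R t

get-beyond : ∀ Xs k → length Xs ≤ k → get Xs k ≡ 0
get-beyond [] k p = refl
get-beyond (x ∷ Xs) (suc k) (s≤s p) = get-beyond Xs k p

get-middle : ∀ L2 b L3 → get (L2 ++ b ∷ L3) (length L2) ≡ b
get-middle [] b L3 = refl
get-middle (x ∷ L2) b L3 = get-middle L2 b L3

get-middle-other : ∀ L2 b b' L3 k → k ≢ length L2 → get (L2 ++ b ∷ L3) k ≡ get (L2 ++ b' ∷ L3) k
get-middle-other [] b b' L3 zero ne = ⊥-elim (ne refl)
get-middle-other [] b b' L3 (suc k) ne = refl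
get-middle-other (x ∷ L2) b b' L3 zero ne = refl
get-middle-other (x ∷ L2) b b' L3 (suc k) ne = get-middle-other L2 b b' L3 k (λ e → ne (cong suc e))

get-two-other : ∀ L1 a a' L2 b b' L3 k → k ≢ length L1 → k ≢ suc (length L1 + length L2) →
  get (L1 ++ a ∷ L2 ++ b ∷ L3) k ≡ get (L1 ++ a' ∷ L2 ++ b' ∷ L3) k
get-two-other [] a a' L2 b b' L3 zero ne1 ne2 = ⊥-elim (ne1 refl)
get-two-other [] a a' L2 b b' L3 (suc k) ne1 ne2 = get-middle-other L2 b b' L3 k (λ e → ne2 (cong suc e))
get-two-other (x ∷ L1) a a' L2 b b' L3 zero ne1 ne2 = refl
get-two-other (x ∷ L1) a a' L2 b b' L3 (suc k) ne1 ne2 =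
  get-two-other L1 a a' L2 b b' L3 k (λ e → ne1 (cong suc e)) (λ e → ne2 (cong suc e))

get-++-suc : ∀ Xs R s → get (Xs ++ R) (suc (length Xs + s)) ≡ get R (suc s)
get-++-suc Xs R s = trans (cong (get (Xs ++ R)) (sym (+-suc (length Xs) s))) (get-++ʳ Xs R (suc s))

get-at : ∀ Xs a R k → length Xs ≡ k → get (Xs ++ a ∷ R) k ≡ a
get-at Xs a R k refl = get-middle Xs a R

get-after : ∀ Xs R s k → length Xs ≡ k → get (Xs ++ R) (suc (k + s)) ≡ get R (suc s)
get-after Xs R s k refl = get-++-suc Xs R s

get-at-suc : ∀ A a b C k → length A ≡ k → get (A ++ a ∷ b ∷ C) (suc k) ≡ b
get-at-suc A a b C k e = trans (cong (λ z → get (A ++ a ∷ b ∷ C) (suc z)) (sym (+-identityʳ k))) (get-after A (a ∷ b ∷ C) 0 k e)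

take-++-length : ∀ (B R : List ℕ) → take (length B) (B ++ R) ≡ B
take-++-length [] R = refl
take-++-length (b ∷ B) R = cong (b ∷_) (take-++-length B R)

sum-two-step : ∀ L1 a L2 b L3 a' b' → a + b ≡ a' + b' + 1 →
  sum (L1 ++ a ∷ L2 ++ b ∷ L3) ≡ sum (L1 ++ a' ∷ L2 ++ b' ∷ L3) + 1
sum-two-step L1 a L2 b L3 a' b' hs
  rewrite sum-++ L1 (a ∷ L2 ++ b ∷ L3) | sum-++ L2 (b ∷ L3) | sum-++ L1 (a' ∷ L2 ++ b' ∷ L3) | sum-++ L2 (b' ∷ L3) =
    trans (cong (sum L1 +_) (e1 a b (sum L2) (sum L3)))
     (trans (cong (λ u → sum L1 + (sum L2 + (u + sum L3))) hs)
      (e2 (sum L1) a' b' (sum L2) (sum L3)))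
  where
  e1 : ∀ a b p q → a + (p + (b + q)) ≡ p + ((a + b) + q)
  e1 = solve 4 (λ a b p q → a :+ (p :+ (b :+ q)) := p :+ ((a :+ b) :+ q)) refl
  e2 : ∀ l a b p q → l + (p + ((a + b + 1) + q)) ≡ l + (a + (p + (b + q))) + 1
  e2 = solve 5 (λ l a b p q → l :+ (p :+ ((a :+ b :+ con 1) :+ q)) := l :+ (a :+ (p :+ (b :+ q))) :+ con 1) refl

sum-zeros : ∀ xs → All (_≡ 0) xs → sum xs ≡ 0
sum-zeros [] [] = refl
sum-zeros (x ∷ xs) (refl ∷ ps) = sum-zeros xs ps

sum-step : ∀ A a C → sum (A ++ suc a ∷ 0 ∷ C) ≡ suc (sum (A ++ 0 ∷ a ∷ C))
sum-step A a C rewrite sum-++ A (suc a ∷ 0 ∷ C) | sum-++ A (0 ∷ a ∷ C) = +-suc (sum A) _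

zeros-eq : ∀ xs ys → All (_≡ 0) xs → All (_≡ 0) ys → length xs ≡ length ys → xs ≡ ys
zeros-eq [] [] _ _ _ = refl
zeros-eq (x ∷ xs) (y ∷ ys) (refl ∷ p) (refl ∷ q) l = cong (0 ∷_) (zeros-eq xs ys p q (suc-injective l))

splitAt : ∀ (P : List ℕ) k → k < length P → Σ (List ℕ) λ A → Σ ℕ λ y → Σ (List ℕ) λ Z → (P ≡ A ++ y ∷ Z) × (length A ≡ k)
splitAt (p ∷ P) zero _ = [] , p , P , refl , refl
splitAt (p ∷ P) (suc k) (s≤s h) with splitAt P k h
... | A , y , Z , e , l = p ∷ A , y , Z , cong (p ∷_) e , cong suc l

split2 : ∀ (P : List ℕ) k → suc k < length P →
  Σ (List ℕ) λ A → Σ ℕ λ a → Σ ℕ λ b → Σ (List ℕ) λ C → (P ≡ A ++ a ∷ b ∷ C) × (length A ≡ k)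
split2 (p ∷ q ∷ P) zero _ = [] , p , q , P , refl , refl
split2 (p ∷ P) (suc k) (s≤s h) with split2 P k h
... | A , a , b , C , e , l = p ∷ A , a , b , C , cong (p ∷_) e , cong suc l

<⇒∃-suc-+ : ∀ {i j} → i < j → ∃[ t ] (j ≡ suc (i + t))
<⇒∃-suc-+ {zero} {suc j} _ = j , refl
<⇒∃-suc-+ {suc i} {suc j} (s≤s p) with <⇒∃-suc-+ {i} {j} p
... | t , e = t , cong suc e

++-cancel : ∀ (A A' R R' : List ℕ) → length A ≡ length A' → A ++ R ≡ A' ++ R' → (A ≡ A') × (R ≡ R')
++-cancel [] [] R R' _ e = refl , e
++-cancel (a ∷ A) (a' ∷ A') R R' l e with ∷-injective e
... | h , t with ++-cancel A A' R R' (suc-injective l) t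
... | e1 , e2 = cong₂ _∷_ h e1 , e2

length-swap-adjacent : ∀ A x y x' y' (C : List ℕ) → length (A ++ x ∷ y ∷ C) ≡ length (A ++ x' ∷ y' ∷ C)
length-swap-adjacent [] x y x' y' C = refl
length-swap-adjacent (z ∷ A) x y x' y' C = cong suc (length-swap-adjacent A x y x' y' C)

length-prefix< : ∀ A x y (C : List ℕ) m → length (A ++ x ∷ y ∷ C) ≡ suc m → length A < m
length-prefix< A x y C m e =
  ≤-pred (subst (2 + length A ≤_) (trans (sym (length-++ A)) e)
    (≤-trans (≤-reflexive (+-comm 2 (length A))) (+-monoʳ-≤ (length A) (s≤s (s≤s z≤n)))))

-- Equality of compositions: entries agree, missing entries counting as 0.
record _≐_ (α β : List ℕ) : Set where
  constructor mk≐
  field entry : ∀ k → get α k ≡ get β k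

open _≐_

≐-tail : ∀ {x y α β} → (x ∷ α) ≐ (y ∷ β) → α ≐ β
≐-tail (mk≐ e) = mk≐ (λ k → e (suc k))

≐-sum : ∀ α β → α ≐ β → sum α ≡ sum β
≐-sum [] [] e = refl
≐-sum (x ∷ α) [] (mk≐ e) = cong₂ _+_ (e 0) (≐-sum α [] (mk≐ (λ k → e (suc k))))
≐-sum [] (y ∷ β) (mk≐ e) = cong₂ _+_ (e 0) (≐-sum [] β (mk≐ (λ k → e (suc k))))
≐-sum (x ∷ α) (y ∷ β) e = cong₂ _+_ (entry e 0) (≐-sum α β (≐-tail e))

≐⇒≡ : ∀ α β → length α ≡ length β → α ≐ β → α ≡ β
≐⇒≡ [] [] _ _ = refl
≐⇒≡ (x ∷ α) (y ∷ β) l e = cong₂ _∷_ (entry e 0) (≐⇒≡ α β (suc-injective l) (≐-tail e))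

≐-sym : ∀ {α β} → α ≐ β → β ≐ α
≐-sym (mk≐ e) = mk≐ (λ k → sym (e k))

≐-trans : ∀ {α β γ} → α ≐ β → β ≐ γ → α ≐ γ
≐-trans (mk≐ e) (mk≐ f) = mk≐ (λ k → trans (e k) (f k))

≡⇒≐ : ∀ {α β} → α ≡ β → α ≐ β
≡⇒≐ refl = mk≐ (λ _ → refl)

Unique-resp-↭ : ∀ {xs ys : List ℕ} → xs ↭ ys → Unique xs → Unique ys
Unique-resp-↭ p = PermProps.Unique-resp-↭ (setoid ℕ) (↭⇒↭ₛ p)

Unique-++⁻ʳ : ∀ A {R : List ℕ} → Unique (A ++ R) → Unique R
Unique-++⁻ʳ [] u = u
Unique-++⁻ʳ (a ∷ A) (_ ∷ u) = Unique-++⁻ʳ A u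

Unique-disjoint : ∀ A {R : List ℕ} → Unique (A ++ R) → ∀ {x} → x ∈ R → x ∉ A
Unique-disjoint (a ∷ A) (a∉ ∷ u) x∈R (here refl) = All.lookup a∉ (∈-++⁺ʳ A x∈R) refl
Unique-disjoint (a ∷ A) (_ ∷ u) x∈R (there x∈A) = Unique-disjoint A u x∈R x∈A

Unique-middle : ∀ B {x C} → Unique (B ++ x ∷ C) → x ∉ B
Unique-middle B u = Unique-disjoint B u (here refl)

Unique-adjacent : ∀ A {a b C} → Unique (A ++ a ∷ b ∷ C) → a ≢ b
Unique-adjacent A u with Unique-++⁻ʳ A u
... | (a≢b ∷ _) ∷ _ = a≢b

interval : ℕ → ℕ → List ℕ
interval s zero = []
interval s (suc n) = s ∷ interval (suc s) n

length-interval : ∀ s n → length (interval s n) ≡ n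
length-interval s zero = refl
length-interval s (suc n) = cong suc (length-interval (suc s) n)

interval-≥ : ∀ s n → All (s ≤_) (interval s n)
interval-≥ s zero = []
interval-≥ s (suc n) = ≤-refl ∷ All.map (≤-trans (n≤1+n s)) (interval-≥ (suc s) n)

interval-unique : ∀ s n → Unique (interval s n)
interval-unique s zero = []
interval-unique s (suc n) = All.map (λ s<x → <⇒≢ s<x) (interval-≥ (suc s) n) ∷ interval-unique (suc s) n

interval-∈ : ∀ s n y → s ≤ y → y < s + n → y ∈ interval s n
interval-∈ s zero y sy yn = ⊥-elim (<⇒≱ yn (subst (_≤ y) (sym (+-identityʳ s)) sy))
interval-∈ s (suc n) y sy yn with s ≟ y
... | yes refl = here refl
... | no ne = there (interval-∈ (suc s) n y (≤∧≢⇒< sy ne) (subst (y <_) (+-suc s n) yn))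

interval-< : ∀ s n y → y ∈ interval s n → y < s + n
interval-< s (suc n) y (here refl) = subst (s <_) (sym (+-suc s n)) (s≤s (m≤m+n s n))
interval-< s (suc n) y (there m) = subst (y <_) (sym (+-suc s n)) (interval-< (suc s) n y m)

swapAt : ℕ → List ℕ → List ℕ
swapAt zero (x ∷ y ∷ xs) = y ∷ x ∷ xs
swapAt zero xs = xs
swapAt (suc i) [] = []
swapAt (suc i) (x ∷ xs) = x ∷ swapAt i xs

swapAt-split : ∀ A a b C → swapAt (length A) (A ++ a ∷ b ∷ C) ≡ A ++ b ∷ a ∷ C
swapAt-split [] a b C = refl
swapAt-split (x ∷ A) a b C = cong (x ∷_) (swapAt-split A a b C)

swapAt-↭ : ∀ i P → swapAt i P ↭ P
swapAt-↭ zero [] = ↭-refl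
swapAt-↭ zero (x ∷ []) = ↭-refl
swapAt-↭ zero (x ∷ y ∷ P) = ↭-swap y x ↭-refl
swapAt-↭ (suc i) [] = ↭-refl
swapAt-↭ (suc i) (x ∷ P) = ↭-prep x (swapAt-↭ i P)

swapAt-map : ∀ (f : ℕ → ℕ) i P → swapAt i (map f P) ≡ map f (swapAt i P)
swapAt-map f zero [] = refl
swapAt-map f zero (x ∷ []) = refl
swapAt-map f zero (x ∷ y ∷ P) = refl
swapAt-map f (suc i) [] = refl
swapAt-map f (suc i) (x ∷ P) = cong (f x ∷_) (swapAt-map f i P)


-- Lehmer codes

lehmer : List ℕ → List ℕ
lehmer [] = []
lehmer (x ∷ xs) = #below x xs ∷ lehmer xs

inversions : List ℕ → ℕ
inversions P = sum (lehmer P)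

lehmerIn : List ℕ → List ℕ → List ℕ
lehmerIn [] R = []
lehmerIn (a ∷ A) R = #below a (A ++ R) ∷ lehmerIn A R

lehmer-++ : ∀ A R → lehmer (A ++ R) ≡ lehmerIn A R ++ lehmer R
lehmer-++ [] R = refl
lehmer-++ (a ∷ A) R = cong (#below a (A ++ R) ∷_) (lehmer-++ A R)

length-lehmerIn : ∀ A R → length (lehmerIn A R) ≡ length A
length-lehmerIn [] R = refl
length-lehmerIn (a ∷ A) R = cong suc (length-lehmerIn A R)

length-lehmer : ∀ A → length (lehmer A) ≡ length A
length-lehmer [] = refl
length-lehmer (a ∷ A) = cong suc (length-lehmer A)

lehmerIn-cong : ∀ A {R R'} → All (λ b → #below b R ≡ #below b R') A → lehmerIn A R ≡ lehmerIn A R'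
lehmerIn-cong [] [] = refl
lehmerIn-cong (a ∷ A) {R} {R'} (e ∷ es) =
  cong₂ _∷_ (trans (#below-++ a A R) (trans (cong (#below a A +_) e) (sym (#below-++ a A R')))) (lehmerIn-cong A es)

get-lehmer : ∀ Z s → get (lehmer Z) s ≡ #below (get Z s) (drop (suc s) Z)
get-lehmer [] s = refl
get-lehmer (z ∷ Z) zero = refl
get-lehmer (z ∷ Z) (suc s) = get-lehmer Z s

lehmer-at : ∀ A y Z → lehmer (A ++ y ∷ Z) ‼ suc (length A) ≡ #below y Z
lehmer-at A y Z rewrite lehmer-++ A (y ∷ Z) = get-at (lehmerIn A (y ∷ Z)) (#below y Z) (lehmer Z) (length A) (length-lehmerIn A (y ∷ Z))

lehmer-after : ∀ A y Z s → lehmer (A ++ y ∷ Z) ‼ suc (suc (length A) + s) ≡ get (lehmer Z) s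
lehmer-after A y Z s rewrite lehmer-++ A (y ∷ Z) = get-after (lehmerIn A (y ∷ Z)) (lehmer (y ∷ Z)) s (length A) (length-lehmerIn A (y ∷ Z))

lehmer-interval : ∀ s n → All (_≡ 0) (lehmer (interval s n))
lehmer-interval s zero = []
lehmer-interval s (suc n) = ≤all⇒#below≡0 (All.map (≤-trans (n≤1+n s)) (interval-≥ (suc s) n)) ∷ lehmer-interval (suc s) n

lehmer-injective-head : ∀ p q P Q → (p ∷ P) ↭ (q ∷ Q) → #below p P ≡ #below q Q → p < q → ⊥
lehmer-injective-head p q P Q pq e lt = <-irrefl e (<-≤-trans (s≤s (#below-mono P (<⇒≤ lt))) (≤-reflexive h))
  where h : suc (#below q P) ≡ #below q Q
        h = trans (cong (_+ #below q P) (sym (below-< lt))) (trans (#below-resp-↭ q pq) (cong (_+ #below q Q) (below-≥ {q} {q} ≤-refl)))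

lehmer-injective : ∀ P Q → P ↭ Q → lehmer P ≡ lehmer Q → P ≡ Q
lehmer-injective [] [] _ _ = refl
lehmer-injective (p ∷ P) (q ∷ Q) pq e with <-cmp p q | ∷-injective e
... | tri≈ _ refl _ | _ , e′ = cong (p ∷_) (lehmer-injective P Q (drop-∷ pq) e′)
... | tri< lt _ _ | e₀ , _ = ⊥-elim (lehmer-injective-head p q P Q pq e₀ lt)
... | tri> _ _ gt | e₀ , _ = ⊥-elim (lehmer-injective-head q p Q P (↭-sym pq) (sym e₀) gt)

lehmerIn-swap : ∀ A a b C → lehmerIn A (b ∷ a ∷ C) ≡ lehmerIn A (a ∷ b ∷ C)
lehmerIn-swap A a b C = lehmerIn-cong A (All.universal (λ v → solve 3 (λ p q r → q :+ (p :+ r) := p :+ (q :+ r)) refl (below a v) (below b v) (#below v C)) A)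

inversions-swap-ascent : ∀ A a b C → a < b → inversions (A ++ b ∷ a ∷ C) ≡ suc (inversions (A ++ a ∷ b ∷ C))
inversions-swap-ascent A a b C ab rewrite lehmer-++ A (b ∷ a ∷ C) | lehmer-++ A (a ∷ b ∷ C) | lehmerIn-swap A a b C
  | sum-++ (lehmerIn A (a ∷ b ∷ C)) (below a b + #below b C ∷ #below a C ∷ lehmer C)
  | sum-++ (lehmerIn A (a ∷ b ∷ C)) (below b a + #below a C ∷ #below b C ∷ lehmer C)
  | below-< ab | below-≥ {b} {a} (<⇒≤ ab) =
  solve 4 (λ x e f y → x :+ ((con 1 :+ f) :+ (e :+ y)) := con 1 :+ (x :+ ((con 0 :+ e) :+ (f :+ y)))) refl
    (sum (lehmerIn A (a ∷ b ∷ C))) (#below a C) (#below b C) (sum (lehmer C))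

inversions-swap : ∀ A {a b} C → Unique (A ++ a ∷ b ∷ C) →
  (a < b × inversions (A ++ b ∷ a ∷ C) ≡ suc (inversions (A ++ a ∷ b ∷ C))) ⊎
  (b < a × suc (inversions (A ++ b ∷ a ∷ C)) ≡ inversions (A ++ a ∷ b ∷ C))
inversions-swap A {a} {b} C u with <-cmp a b
... | tri< a<b _ _ = inj₁ (a<b , inversions-swap-ascent A a b C a<b)
... | tri≈ _ a≡b _ = ⊥-elim (Unique-adjacent A u a≡b)
... | tri> _ _ b<a = inj₂ (b<a , sym (inversions-swap-ascent A b a C b<a))

-- Exactly the Lehmer codes of lists of distinct entries.
IsCode : List ℕ → Set
IsCode [] = ⊤
IsCode (a ∷ α) = (a ≤ length α) × IsCode α

lehmer-isCode : ∀ P → IsCode (lehmer P)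
lehmer-isCode [] = tt
lehmer-isCode (x ∷ P) = subst (#below x P ≤_) (sym (length-lehmer P)) (#below≤length x P) , lehmer-isCode P

zeros-or-descent : ∀ α → IsCode α → All (_≡ 0) α ⊎ (Σ (List ℕ) λ A → Σ ℕ λ a → Σ (List ℕ) λ C → α ≡ A ++ suc a ∷ 0 ∷ C)
zeros-or-descent [] _ = inj₁ []
zeros-or-descent (x ∷ []) (z≤n , _) = inj₁ (refl ∷ [])
zeros-or-descent (x ∷ y ∷ α) (_ , v) with zeros-or-descent (y ∷ α) v
zeros-or-descent (zero ∷ y ∷ α) (_ , v) | inj₁ ps = inj₁ (refl ∷ ps)
zeros-or-descent (suc a ∷ y ∷ α) (_ , v) | inj₁ (refl ∷ ps) = inj₂ ([] , a , α , refl)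
... | inj₂ (A , a , C , e) = inj₂ (x ∷ A , a , C , cong (x ∷_) e)

isCode-step : ∀ A a C → IsCode (A ++ suc a ∷ 0 ∷ C) → IsCode (A ++ 0 ∷ a ∷ C)
isCode-step [] a C (s≤s p , _ , v) = z≤n , p , v
isCode-step (x ∷ A) a C (p , v) = subst (x ≤_) (length-swap-adjacent A (suc a) 0 0 a C) p , isCode-step A a C v

lehmer-adjacent : ∀ PA p q PC A x y C → length PA ≡ length A → lehmer (PA ++ p ∷ q ∷ PC) ≡ A ++ x ∷ y ∷ C →
  (lehmerIn PA (p ∷ q ∷ PC) ≡ A) × (below q p + #below p PC ≡ x) × (#below q PC ≡ y) × (lehmer PC ≡ C)
lehmer-adjacent PA p q PC A x y C l e
  with ++-cancel (lehmerIn PA (p ∷ q ∷ PC)) A _ _ (trans (length-lehmerIn PA _) l) (trans (sym (lehmer-++ PA (p ∷ q ∷ PC))) e)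
... | A≡ , rest with ∷-injective rest
... | x≡ , rest′ with ∷-injective rest′
... | y≡ , C≡ = A≡ , x≡ , y≡ , C≡

lehmer-swap-ascent : ∀ PA p q PC A a C → Unique (PA ++ p ∷ q ∷ PC) → length PA ≡ length A →
  lehmer (PA ++ p ∷ q ∷ PC) ≡ A ++ 0 ∷ a ∷ C → lehmer (PA ++ q ∷ p ∷ PC) ≡ A ++ suc a ∷ 0 ∷ C
lehmer-swap-ascent PA p q PC A a C u l e with lehmer-adjacent PA p q PC A 0 a C l e
... | A≡ , p-entry , q-entry , C≡ = goal
  where
  p<q : p < q
  p<q with below-cases q p
  ... | inj₁ (_ , e₁) = ⊥-elim (0≢1+n (sym (trans (cong (_+ #below p PC) (sym e₁)) p-entry)))
  ... | inj₂ (p≤q , _) = ≤∧≢⇒< p≤q (Unique-adjacent PA u)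
  p-rest : #below p PC ≡ 0
  p-rest = trans (sym (cong (_+ #below p PC) (below-≥ (<⇒≤ p<q)))) p-entry
  goal : lehmer (PA ++ q ∷ p ∷ PC) ≡ A ++ suc a ∷ 0 ∷ C
  goal rewrite lehmer-++ PA (q ∷ p ∷ PC) | lehmerIn-swap PA p q PC | A≡ | below-< p<q | q-entry | p-rest | C≡ = refl

lehmer-zeros⇒interval : ∀ s P → Unique P → All (s ≤_) P → All (_< s + length P) P → All (_≡ 0) (lehmer P) → P ≡ interval s (length P)
lehmer-zeros⇒interval s [] _ _ _ _ = refl
lehmer-zeros⇒interval s (p ∷ P) (p∉P ∷ u) (s≤p ∷ _) (p<s+n ∷ hi) (z ∷ zs) = cong₂ _∷_ p≡s rec
  where
  p≤P : All (p ≤_) P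
  p≤P = #below≡0⇒≤all P z
  rec : P ≡ interval (suc s) (length P)
  rec = lehmer-zeros⇒interval (suc s) P u
          (All.zipWith (λ (p≢x , p≤x) → ≤-<-trans s≤p (≤∧≢⇒< p≤x p≢x)) (p∉P , p≤P))
          (subst (λ z → All (_< z) P) (+-suc s (length P)) hi) zs
  p≤s : ∀ Q → Q ≡ interval (suc s) (length Q) → All (p ≢_) Q → All (p ≤_) Q → p < s + suc (length Q) → p ≤ s
  p≤s [] _ _ _ p<s+1 = ≤-pred (subst (p <_) (+-comm s 1) p<s+1)
  p≤s (x ∷ Q) e (p≢x ∷ _) (p≤x ∷ _) _ = ≤-pred (subst (p <_) (proj₁ (∷-injective e)) (≤∧≢⇒< p≤x p≢x))
  p≡s : p ≡ s
  p≡s = ≤-antisym (p≤s P rec p∉P p≤P p<s+n) s≤p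

lehmer-descent : ∀ PA p q PC A a C → length PA ≡ length A → lehmer (PA ++ p ∷ q ∷ PC) ≡ A ++ suc a ∷ 0 ∷ C → q < p
lehmer-descent PA p q PC A a C l e with lehmer-adjacent PA p q PC A (suc a) 0 C l e
... | _ , p-entry , q-entry , _ with below-cases q p
... | inj₁ (q<p , _) = q<p
... | inj₂ (p≤q , e₀) = ⊥-elim (0≢1+n (sym (trans (sym p-entry) (trans (cong (_+ #below p PC) e₀)
                          (n≤0⇒n≡0 (subst (#below p PC ≤_) q-entry (#below-mono PC p≤q)))))))


-- The covering relation on Lehmer codes

≤ᵇ-true : ∀ {m n} → m ≤ n → (m ≤ᵇ n) ≡ true
≤ᵇ-true {m} {n} p with m ≤ᵇ n | ≤⇒≤ᵇ p
... | true | _ = refl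

≤ᵇ-false : ∀ {m n} → n < m → (m ≤ᵇ n) ≡ false
≤ᵇ-false {m} {n} p with m ≤ᵇ n in eq
... | false = refl
... | true = ⊥-elim (<⇒≱ p (≤ᵇ⇒≤ m n (subst T (sym eq) tt)))

<ᵇ-true : ∀ {m n} → m < n → (m <ᵇ n) ≡ true
<ᵇ-true {m} {n} p with m <ᵇ n | <⇒<ᵇ p
... | true | _ = refl

<ᵇ-false : ∀ {m n} → n ≤ m → (m <ᵇ n) ≡ false
<ᵇ-false {m} {n} p with m <ᵇ n in eq
... | false = refl
... | true = ⊥-elim (<⇒≱ (<ᵇ⇒< m n (subst T (sym eq) tt)) p)

-- The test in the recursion for c at an entry z of Z compares the code entry of z with the
-- number of entries below V from z on; it succeeds exactly when z < V.
c≡#below-take : ∀ (α : List ℕ) i (Z : List ℕ) V t →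
  α ‼ i ≡ #below V Z →
  (∀ s → s < t → α ‼ suc (i + s) ≡ #below (get Z s) (drop (suc s) Z)) →
  c α i (suc (i + t)) ≡ #below V (take t Z)
c≡#below-take α i Z V zero hX hs rewrite +-identityʳ i | ≤ᵇ-true (≤-refl {suc i}) = refl
c≡#below-take α i Z V (suc t) hX hs rewrite +-suc i t
   | ≤ᵇ-false {suc (suc (i + t))} {suc i} (s≤s (s≤s (m≤m+n i t)))
   | hs t ≤-refl
   | c≡#below-take α i Z V t hX (λ s p → hs s (m≤n⇒m≤1+n p))
   | hX | #below-take-drop V t Z | m+n∸m≡n (#below V (take t Z)) (#below V (drop t Z))
   | sym (#below-take-drop V t Z) = step 0 t Z
  where
  step : ∀ k t Z → (if #below (get Z t) (drop (suc t) Z) <ᵇ #below V (drop t Z)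
                  then suc (k + #below V (take t Z)) else k + #below V (take t Z)) ≡ k + #below V (take (suc t) Z)
  step k zero [] = refl
  step k zero (z ∷ Z) with below-cases z V
  ... | inj₁ (p , e) rewrite e | <ᵇ-true {#below z Z} {suc (#below V Z)} (s≤s (#below-mono Z (<⇒≤ p))) = sym (+-suc k 0)
  ... | inj₂ (p , e) rewrite e | <ᵇ-false {#below z Z} {#below V Z} (#below-mono Z p) = refl
  step k (suc t) [] = refl
  step k (suc t) (z ∷ Z) rewrite sym (+-assoc k (below z V) (#below V (take t Z)))
     | sym (+-assoc k (below z V) (#below V (take (suc t) Z))) = step (k + below z V) t Z

c-lehmer : ∀ A y Z t → c (lehmer (A ++ y ∷ Z)) (suc (length A)) (suc (suc (length A) + t)) ≡ #below y (take t Z)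
c-lehmer A y Z t = c≡#below-take (lehmer (A ++ y ∷ Z)) (suc (length A)) Z y t (lehmer-at A y Z)
  (λ s _ → trans (lehmer-after A y Z s) (get-lehmer Z s))

c-resp : ∀ {α α₁} → α ≐ α₁ → ∀ i j → c α i j ≡ c α₁ i j
c-resp e i zero = refl
c-resp e i (suc j) rewrite c-resp e i j | entry e (pred j) | entry e (pred i) = refl

CoversAt : List ℕ → List ℕ → ℕ → ℕ → Set
CoversAt α α' i j =
  (1 ≤ i) × (i < j) ×
    (suc (α' ‼ i) ≤ α ‼ i) ×
    (α' ‼ j ≡ ((α ‼ j) + (α ‼ i)) ∸ (α' ‼ i) ∸ 1) ×
    (∀ k → 1 ≤ k → k ≢ i → k ≢ j → α' ‼ k ≡ α ‼ k) ×
    (c α i j ≡ c α' i j) × (c α' i j + (α ‼ j) ≡ α' ‼ i)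

CoversAt-unique : ∀ {α β β' i j} → CoversAt α β i j → CoversAt α β' i j → β ‼ i ≡ β' ‼ i → β ≐ β'
CoversAt-unique {α} {β} {β'} {i} {j} (_ , _ , _ , a2 , a3 , _) (_ , _ , _ , a2' , a3' , _) βi = mk≐ same
  where
  same : ∀ k → β ‼ suc k ≡ β' ‼ suc k
  same k with suc k ≟ i | suc k ≟ j
  ... | yes refl | _ = βi
  ... | no _ | yes refl = trans a2 (trans (cong (λ v → (α ‼ j + α ‼ i) ∸ v ∸ 1) βi) (sym a2'))
  ... | no k≢i | no k≢j = trans (a3 (suc k) (s≤s z≤n) k≢i k≢j) (sym (a3' (suc k) (s≤s z≤n) k≢i k≢j))

Covers-resp : ∀ {α α₁ β β₁} → α ≐ α₁ → β ≐ β₁ → Covers α β → Covers α₁ β₁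
Covers-resp {α} {α₁} {β} {β₁} ≐α@(mk≐ eα) ≐β@(mk≐ eβ) (se , i , j , p1 , p2 , a1 , a2 , a3 , a4 , a5) =
  trans (sym (≐-sum α α₁ ≐α)) (trans se (cong (_+ 1) (≐-sum β β₁ ≐β))) ,
  i , j , p1 , p2 ,
  subst₂ _≤_ (cong suc (eβ (pred i))) (eα (pred i)) a1 ,
  trans (sym (eβ (pred j))) (trans a2 (cong₂ (λ u v → u ∸ v ∸ 1) (cong₂ _+_ (eα (pred j)) (eα (pred i))) (eβ (pred i)))) ,
  (λ k p n1 n2 → trans (sym (eβ (pred k))) (trans (a3 k p n1 n2) (eα (pred k)))) ,
  trans (sym (c-resp ≐α i j)) (trans a4 (c-resp ≐β i j)) ,
  trans (cong₂ _+_ (sym (c-resp ≐β i j)) (sym (eα (pred j)))) (trans a5 (eβ (pred i)))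

NoneBetween : List ℕ → ℕ → ℕ → Set
NoneBetween B x y = All (λ b → b < x ⊎ y < b) B

#below-noneBetween : ∀ B {x y} → x < y → NoneBetween B x y → #below y B ≡ #below x B
#below-noneBetween [] xy [] = refl
#below-noneBetween (b ∷ B) {x} {y} xy (inj₁ p ∷ nm) rewrite below-< {b} {y} (<-trans p xy) | below-< p = cong suc (#below-noneBetween B xy nm)
#below-noneBetween (b ∷ B) {x} {y} xy (inj₂ p ∷ nm) rewrite below-≥ {b} {y} (<⇒≤ p) | below-≥ {b} {x} (<⇒≤ (<-trans xy p)) =
  #below-noneBetween B xy nm

lehmerIn-noneBetween : ∀ B {x y} C → x < y → NoneBetween B x y → lehmerIn B (x ∷ C) ≡ lehmerIn B (y ∷ C)
lehmerIn-noneBetween B {x} {y} C xy nm = lehmerIn-cong B (go B nm)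
  where
  go : ∀ B → NoneBetween B x y → All (λ b → #below b (x ∷ C) ≡ #below b (y ∷ C)) B
  go [] [] = []
  go (b ∷ B) (inj₁ p ∷ nm) = cong (_+ #below b C) (trans (below-≥ {x} {b} (<⇒≤ p)) (sym (below-≥ {y} {b} (<⇒≤ (<-trans p xy))))) ∷ go B nm
  go (b ∷ B) (inj₂ p ∷ nm) = cong (_+ #below b C) (trans (below-< {x} {b} (<-trans xy p)) (sym (below-< {y} {b} p))) ∷ go B nm

lehmer-split : ∀ A y B x C → lehmer (A ++ y ∷ B ++ x ∷ C) ≡
  lehmerIn A (y ∷ B ++ x ∷ C) ++ #below y (B ++ x ∷ C) ∷ lehmerIn B (x ∷ C) ++ #below x C ∷ lehmer C
lehmer-split A y B x C =
  trans (lehmer-++ A (y ∷ B ++ x ∷ C)) (cong (λ u → lehmerIn A (y ∷ B ++ x ∷ C) ++ #below y (B ++ x ∷ C) ∷ u) (lehmer-++ B (x ∷ C)))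

-- A Bruhat cover in one-line notation: the values y > x swap places, and no entry between
-- their positions has a value strictly between x and y.
module Transposition (A B C : List ℕ) {x y : ℕ} (x<y : x < y) (gap : NoneBetween B x y) where

  P P′ : List ℕ
  P = A ++ y ∷ B ++ x ∷ C
  P′ = A ++ x ∷ B ++ y ∷ C

  i j : ℕ
  i = suc (length A)
  j = suc (suc (length A) + length B)

  lehmer-split′ : lehmer P′ ≡
    lehmerIn A (y ∷ B ++ x ∷ C) ++ #below x (B ++ y ∷ C) ∷ lehmerIn B (x ∷ C) ++ #below y C ∷ lehmer C
  lehmer-split′ rewrite lehmer-split A x B y C
    | lehmerIn-cong A {x ∷ B ++ y ∷ C} {y ∷ B ++ x ∷ C} (All.universal (λ v → #below-swap v x B y C) A)
    | lehmerIn-noneBetween B C x<y gap = refl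

  lehmer-other : ∀ k → k ≢ length A → k ≢ suc (length A + length B) → get (lehmer P′) k ≡ get (lehmer P) k
  lehmer-other k k≢i k≢j rewrite lehmer-split′ | lehmer-split A y B x C =
    get-two-other (lehmerIn A _) _ _ (lehmerIn B _) _ _ (lehmer C) k
      (λ eq → k≢i (trans eq (length-lehmerIn A _)))
      (λ eq → k≢j (trans eq (cong₂ (λ p q → suc (p + q)) (length-lehmerIn A _) (length-lehmerIn B _))))

  u e f : ℕ
  u = #below x B
  e = #below x C
  f = #below y C

  #below-y : #below y (B ++ x ∷ C) ≡ u + (1 + f)
  #below-y rewrite #below-++ y B (x ∷ C) | below-< x<y | #below-noneBetween B x<y gap = refl

  #below-x : #below x (B ++ y ∷ C) ≡ u + e
  #below-x rewrite #below-++ x B (y ∷ C) | below-≥ {y} {x} (<⇒≤ x<y) = refl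

  αi : lehmer P ‼ i ≡ u + (1 + f)
  αi = trans (lehmer-at A y _) #below-y

  αj : lehmer P ‼ j ≡ e
  αj = trans (lehmer-after A y _ (length B)) (lehmer-at B x C)

  βi : lehmer P′ ‼ i ≡ u + e
  βi = trans (lehmer-at A x _) #below-x

  βj : lehmer P′ ‼ j ≡ f
  βj = trans (lehmer-after A x _ (length B)) (lehmer-at B y C)

  cα : c (lehmer P) i j ≡ u
  cα = trans (c-lehmer A y (B ++ x ∷ C) (length B))
         (trans (cong (#below y) (take-++-length B _)) (#below-noneBetween B x<y gap))

  cβ : c (lehmer P′) i j ≡ u
  cβ = trans (c-lehmer A x (B ++ y ∷ C) (length B)) (cong (#below x) (take-++-length B _))

  coversAt : CoversAt (lehmer P) (lehmer P′) i j
  coversAt = s≤s z≤n , s≤s (s≤s (m≤m+n _ _)) , a1 , a2 , a3 , trans cα (sym cβ) ,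
             trans (cong₂ _+_ cβ αj) (sym βi)
    where
    a1 : suc (lehmer P′ ‼ i) ≤ lehmer P ‼ i
    a1 rewrite αi | βi = subst (_≤ u + (1 + f)) (+-suc u e) (+-monoʳ-≤ u (s≤s (#below-mono C (<⇒≤ x<y))))
    a2 : lehmer P′ ‼ j ≡ ((lehmer P ‼ j) + (lehmer P ‼ i)) ∸ (lehmer P′ ‼ i) ∸ 1
    a2 rewrite αi | αj | βi | βj
       | solve 3 (λ u e f → e :+ (u :+ (con 1 :+ f)) := (u :+ e) :+ (con 1 :+ f)) refl u e f
       | m+n∸m≡n (u + e) (1 + f) = refl
    a3 : ∀ k → 1 ≤ k → k ≢ i → k ≢ j → lehmer P′ ‼ k ≡ lehmer P ‼ k
    a3 (suc k) _ k≢i k≢j = lehmer-other k (λ eq → k≢i (cong suc eq)) (λ eq → k≢j (cong suc eq))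

  sum-lehmer : sum (lehmer P) ≡ sum (lehmer P′) + 1
  sum-lehmer rewrite lehmer-split A y B x C | lehmer-split′ | #below-y | #below-x =
    sum-two-step (lehmerIn A _) _ (lehmerIn B _) e (lehmer C) (u + e) f
      (solve 3 (λ u e f → (u :+ (con 1 :+ f)) :+ e := (u :+ e) :+ f :+ con 1) refl u e f)

  covers : Covers (lehmer P) (lehmer P′)
  covers = sum-lehmer , i , j , coversAt

noneBetween-intro : ∀ B {x y} → x ∉ B → y ∉ B → All (λ b → b < suc x ⊎ y ≤ b) B → NoneBetween B x y
noneBetween-intro [] _ _ [] = []
noneBetween-intro (b ∷ B) nx ny (inj₁ p ∷ ps) =
  inj₁ (≤∧≢⇒< (≤-pred p) (λ e → nx (here (sym e)))) ∷ noneBetween-intro B (λ m → nx (there m)) (λ m → ny (there m)) ps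
noneBetween-intro (b ∷ B) nx ny (inj₂ p ∷ ps) =
  inj₂ (≤∧≢⇒< p (λ e → ny (here e))) ∷ noneBetween-intro B (λ m → nx (there m)) (λ m → ny (there m)) ps

-- V plays the role of the value that the cover puts at position i: counting with V must agree
-- with counting with x on B ++ x ∷ C and with y on B, which pins V to (x, y] and leaves no
-- entry of B strictly between x and y.
noneBetween-of-counts : ∀ B C {x y V} → Unique (y ∷ B ++ x ∷ C) → x < y →
  #below V (B ++ x ∷ C) ≡ #below y B + #below x C → #below y B ≡ #below V B → NoneBetween B x y
noneBetween-of-counts B C {x} {y} {V} (y∉ ∷ u) x<y hV eqB =
  noneBetween-intro B (Unique-middle B u) (λ y∈B → All.lookup y∉ (∈-++⁺ˡ y∈B) refl)
    (#below-equal⇒gap B (suc x) y x<y sx)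
  where
  V≤x : V ≤ x
  V≤x with V ≤? x
  ... | yes p = p
  ... | no p = ⊥-elim (<-irrefl (sym hV) big)
    where
    big : #below y B + #below x C < #below V (B ++ x ∷ C)
    big rewrite #below-++ V B (x ∷ C) | below-< (≰⇒> p) | sym eqB =
      +-monoʳ-< (#below y B) (s≤s (#below-mono C (<⇒≤ (≰⇒> p))))
  sx : #below (suc x) B ≡ #below y B
  sx = ≤-antisym (#below-mono B x<y) (subst (_≤ #below (suc x) B) (sym eqB) (#below-mono B (≤-trans V≤x (n≤1+n x))))

Covers⇒transposition-at : ∀ A y B x C β → Unique (A ++ y ∷ B ++ x ∷ C) →
  CoversAt (lehmer (A ++ y ∷ B ++ x ∷ C)) β (suc (length A)) (suc (suc (length A) + length B)) →
  (x < y) × NoneBetween B x y × (β ≐ lehmer (A ++ x ∷ B ++ y ∷ C))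
Covers⇒transposition-at A y B x C β d cov@(_ , _ , a1 , _ , a3 , a4 , a5) = x<y , gap , β≈
  where
  Z = B ++ x ∷ C
  i = suc (length A)
  j = suc (i + length B)
  dyZ : Unique (y ∷ Z)
  dyZ = Unique-++⁻ʳ A d
  βi : β ‼ i ≡ #below y B + #below x C
  βi = trans (sym a5) (cong₂ _+_ (trans (sym a4) (trans (c-lehmer A y Z (length B)) (cong (#below y) (take-++-length B _))))
                                  (trans (lehmer-after A y Z (length B)) (lehmer-at B x C)))
  αi : lehmer (A ++ y ∷ Z) ‼ i ≡ #below y B + (below x y + #below y C)
  αi = trans (lehmer-at A y Z) (#below-++ y B (x ∷ C))
  x<y : x < y
  x<y with below-cases x y
  ... | inj₁ (p , _) = p
  ... | inj₂ (p , e0) = ⊥-elim (<⇒≱ (subst₂ _<_ βi (trans αi (cong (λ z → #below y B + (z + #below y C)) e0)) a1)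
                                  (+-monoʳ-≤ (#below y B) (#below-mono C p)))
  V-exists : ∃[ V ] (#below V Z ≡ β ‼ i)
  V-exists = discrete-ivt (λ V → #below V Z) (#below-zero Z) (λ V → #below-suc≤ V Z (AllPairs.tail dyZ)) y (β ‼ i)
               (≤-trans (n≤1+n _) (subst (suc (β ‼ i) ≤_) (lehmer-at A y Z) a1))
  V = proj₁ V-exists
  cβ : c β i j ≡ #below V B
  cβ = trans (c≡#below-take β i Z V (length B) (sym (proj₂ V-exists)) hs) (cong (#below V) (take-++-length B (x ∷ C)))
    where
    hs : ∀ s → s < length B → β ‼ suc (i + s) ≡ #below (get Z s) (drop (suc s) Z)
    hs s st = trans (a3 (suc (i + s)) (s≤s z≤n) (λ e' → <⇒≢ (s≤s (m≤m+n i s)) (sym e'))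
                        (λ e' → <⇒≢ (s≤s (+-monoʳ-< i st)) e'))
                 (trans (lehmer-after A y Z s) (get-lehmer Z s))
  gap : NoneBetween B x y
  gap = noneBetween-of-counts B C dyZ x<y (trans (proj₂ V-exists) βi)
          (trans (sym (trans (c-lehmer A y Z (length B)) (cong (#below y) (take-++-length B _)))) (trans a4 cβ))
  open Transposition A B C x<y gap using (coversAt) renaming (βi to βi′)
  β≈ : β ≐ lehmer (A ++ x ∷ B ++ y ∷ C)
  β≈ = CoversAt-unique cov coversAt (trans βi (trans (cong (_+ #below x C) (#below-noneBetween B x<y gap)) (sym βi′)))

CoversAt-lehmer-i : ∀ P β {i j} → CoversAt (lehmer P) β (suc i) j → i < length P
CoversAt-lehmer-i P β {i} (_ , _ , a1 , _) with i <? length P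
... | yes i<n = i<n
... | no i≮n =
  ⊥-elim (<⇒≱ (s≤s z≤n) (subst (suc (β ‼ suc i) ≤_) (get-beyond (lehmer P) i (subst (_≤ i) (sym (length-lehmer P)) (≮⇒≥ i≮n))) a1))

-- A cover reaching past the end would have to keep α_i unchanged, contradicting (a1).
CoversAt-lehmer-j : ∀ A y Z β t → CoversAt (lehmer (A ++ y ∷ Z)) β (suc (length A)) (suc (suc (length A) + t)) → t < length Z
CoversAt-lehmer-j A y Z β t (_ , _ , a1 , _ , _ , a4 , a5) with t <? length Z
... | yes t<n = t<n
... | no t≮n = ⊥-elim (<-irrefl βi a1)
  where
  βi : β ‼ suc (length A) ≡ lehmer (A ++ y ∷ Z) ‼ suc (length A)
  βi = trans (sym a5) (trans (cong₂ _+_ (sym a4)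
                                 (trans (lehmer-after A y Z t) (get-beyond (lehmer Z) t (subst (_≤ t) (sym (length-lehmer Z)) (≮⇒≥ t≮n)))))
         (trans (+-identityʳ _) (trans (c-lehmer A y Z t) (trans (cong (#below y) (take-all t Z (≮⇒≥ t≮n))) (sym (lehmer-at A y Z))))))

TranspositionOf : List ℕ → List ℕ → Set
TranspositionOf P β = Σ (List ℕ) λ A → Σ (List ℕ) λ B → Σ (List ℕ) λ C → Σ ℕ λ x → Σ ℕ λ y →
  (P ≡ A ++ y ∷ B ++ x ∷ C) × (x < y) × NoneBetween B x y × (β ≐ lehmer (A ++ x ∷ B ++ y ∷ C))

Covers⇒transposition : ∀ P β → Unique P → Covers (lehmer P) β → TranspositionOf P β
Covers⇒transposition P β d (_ , zero , j , () , _)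
Covers⇒transposition P β d (_ , suc i , j , cov@(_ , i<j , _))
  with splitAt P i (CoversAt-lehmer-i P β cov)
... | A , y , Z , refl , refl with <⇒∃-suc-+ i<j
... | t , refl with splitAt Z t (CoversAt-lehmer-j A y Z β t cov)
... | B , x , C , refl , refl with Covers⇒transposition-at A y B x C β d cov
... | x<y , gap , β≈ = A , B , C , x , y , refl , x<y , gap , β≈


-- Words

-- The one-line notation of the product of a word: the identity list 0 … m with s_i acting by
-- swapping positions i and i + 1.
wordLine : ∀ {m} → List (Fin m) → List ℕ
wordLine {m} [] = interval 0 (suc m)
wordLine (i ∷ w) = swapAt (toℕ i) (wordLine w)

wordLine-↭ : ∀ {m} (w : List (Fin m)) → wordLine w ↭ interval 0 (suc m)
wordLine-↭ [] = ↭-refl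
wordLine-↭ (i ∷ w) = ↭-trans (swapAt-↭ (toℕ i) (wordLine w)) (wordLine-↭ w)

length-wordLine : ∀ {m} (w : List (Fin m)) → length (wordLine w) ≡ suc m
length-wordLine {m} w = trans (↭-length (wordLine-↭ w)) (length-interval 0 (suc m))

wordLine-unique : ∀ {m} (w : List (Fin m)) → Unique (wordLine w)
wordLine-unique {m} w = Unique-resp-↭ (↭-sym (wordLine-↭ w)) (interval-unique 0 (suc m))

wordLine-bounded : ∀ {m} (w : List (Fin m)) → All (_< suc m) (wordLine w)
wordLine-bounded {m} w = All-resp-↭ (↭-sym (wordLine-↭ w)) (All.tabulate (interval-< 0 (suc m) _))

wordLine-split : ∀ {m} (i : Fin m) (w : List (Fin m)) → Σ (List ℕ) λ A → Σ ℕ λ a → Σ ℕ λ b → Σ (List ℕ) λ C →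
  (wordLine w ≡ A ++ a ∷ b ∷ C) × (length A ≡ toℕ i)
wordLine-split {m} i w = split2 (wordLine w) (toℕ i) (subst (suc (suc (toℕ i)) ≤_) (sym (length-wordLine w)) (s≤s (toℕ<n i)))

wordLine-∷ : ∀ {m} (i : Fin m) (w : List (Fin m)) A a b C → wordLine w ≡ A ++ a ∷ b ∷ C → length A ≡ toℕ i →
  wordLine (i ∷ w) ≡ A ++ b ∷ a ∷ C
wordLine-∷ i w A a b C e l = trans (cong (swapAt (toℕ i)) e) (trans (cong (λ z → swapAt z (A ++ a ∷ b ∷ C)) (sym l)) (swapAt-split A a b C))

-- Every letter of the word increases the number of inversions.
Ascending : ∀ {m} → List (Fin m) → Set
Ascending [] = ⊤
Ascending (i ∷ w) = (get (wordLine w) (toℕ i) < get (wordLine w) (suc (toℕ i))) × Ascending w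

ascent-values : ∀ {m} (i : Fin m) (w : List (Fin m)) {A a b C} → get (wordLine w) (toℕ i) < get (wordLine w) (suc (toℕ i)) →
  wordLine w ≡ A ++ a ∷ b ∷ C → length A ≡ toℕ i → a < b
ascent-values i w {A} {a} {b} {C} asc e l =
  subst₂ _<_ (trans (cong (λ P → get P (toℕ i)) e) (get-at A a (b ∷ C) (toℕ i) l))
             (trans (cong (λ P → get P (suc (toℕ i))) e) (get-at-suc A a b C (toℕ i) l)) asc

inversions-wordLine≤length : ∀ {m} (w : List (Fin m)) → inversions (wordLine w) ≤ length w
inversions-wordLine≤length {m} [] = ≤-reflexive (sum-zeros (lehmer (interval 0 (suc m))) (lehmer-interval 0 (suc m)))
inversions-wordLine≤length (i ∷ w) with wordLine-split i w
... | A , a , b , C , e , l rewrite wordLine-∷ i w A a b C e l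
  with inversions-swap A C (subst Unique e (wordLine-unique w))
... | inj₁ (_ , up) = subst (_≤ suc (length w)) (sym up) (s≤s IH)
  where IH = subst (λ P → inversions P ≤ length w) e (inversions-wordLine≤length w)
... | inj₂ (_ , down) = ≤-trans (n≤1+n _) (≤-trans (≤-reflexive down) (≤-trans IH (n≤1+n _)))
  where IH = subst (λ P → inversions P ≤ length w) e (inversions-wordLine≤length w)

ascending-of-length≤inversions : ∀ {m} (w : List (Fin m)) → length w ≤ inversions (wordLine w) → Ascending w
ascending-of-length≤inversions [] _ = tt
ascending-of-length≤inversions (i ∷ w) long with wordLine-split i w
... | A , a , b , C , e , l with inversions-swap A C (subst Unique e (wordLine-unique w))
... | inj₁ (a<b , up) = ascent , ascending-of-length≤inversions w (≤-pred (≤-trans long (≤-reflexive step)))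
  where
  ascent : get (wordLine w) (toℕ i) < get (wordLine w) (suc (toℕ i))
  ascent = subst (λ P → get P (toℕ i) < get P (suc (toℕ i))) (sym e)
             (subst₂ _<_ (sym (get-at A a (b ∷ C) (toℕ i) l)) (sym (get-at-suc A a b C (toℕ i) l)) a<b)
  step : inversions (wordLine (i ∷ w)) ≡ suc (inversions (wordLine w))
  step = trans (cong inversions (wordLine-∷ i w A a b C e l)) (trans up (cong (λ P → suc (inversions P)) (sym e)))
... | inj₂ (_ , down) = ⊥-elim (1+n≰n (≤-trans (n≤1+n _) (≤-trans (s≤s long′) (≤-trans (≤-reflexive down) old≤))))
  where
  long′ : suc (length w) ≤ inversions (A ++ b ∷ a ∷ C)
  long′ = subst (λ P → suc (length w) ≤ inversions P) (wordLine-∷ i w A a b C e l) long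
  old≤ : inversions (A ++ a ∷ b ∷ C) ≤ length w
  old≤ = subst (λ P → inversions P ≤ length w) e (inversions-wordLine≤length w)

realize-code : ∀ {m} n α → sum α ≡ n → IsCode α → length α ≡ suc m →
  Σ (List (Fin m)) λ w → (lehmer (wordLine w) ≡ α) × (length w ≡ n)
realize-code {m} n α sα v lα with zeros-or-descent α v
... | inj₁ zs = [] , zeros-eq _ _ (lehmer-interval 0 (suc m)) zs (trans (length-lehmer (interval 0 (suc m))) (trans (length-interval 0 (suc m)) (sym lα))) ,
                   trans (sym (sum-zeros α zs)) sα
realize-code {m} zero α sα v lα | inj₂ (A , a , C , refl) = ⊥-elim (0≢1+n (trans (sym sα) (sum-step A a C)))
realize-code {m} (suc n) α sα v lα | inj₂ (A , a , C , refl)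
  with realize-code {m} n (A ++ 0 ∷ a ∷ C) (suc-injective (trans (sym (sum-step A a C)) sα)) (isCode-step A a C v)
                 (trans (length-swap-adjacent A 0 a (suc a) 0 C) lα)
... | w , lehmer≡ , length≡ with split2 (wordLine w) (length A) (subst (suc (suc (length A)) ≤_) (sym (length-wordLine w)) (s≤s A<m))
  where A<m = length-prefix< A (suc a) 0 C m lα
... | PA , p , q , PC , eP , lPA =
  fromℕ< A<m ∷ w ,
  trans (cong lehmer (wordLine-∷ (fromℕ< A<m) w PA p q PC eP (trans lPA (sym (toℕ-fromℕ< A<m)))))
    (lehmer-swap-ascent PA p q PC A a C (subst Unique eP (wordLine-unique w)) lPA (trans (cong lehmer (sym eP)) lehmer≡)) ,
  cong suc length≡
  where A<m = length-prefix< A (suc a) 0 C m lα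

-- Bubble sort: undo descents one at a time, each lowering the number of inversions by one.
word-of-list : ∀ {m} n P → inversions P ≡ n → Unique P → All (_< suc m) P → length P ≡ suc m → Σ (List (Fin m)) λ w → P ≡ wordLine w
word-of-list {m} n P sP u bP lP with zeros-or-descent (lehmer P) (lehmer-isCode P)
... | inj₁ zs = [] , trans (lehmer-zeros⇒interval 0 P u (All.universal (λ _ → z≤n) P) (subst (λ z → All (_< z) P) (sym lP) bP) zs) (cong (interval 0) lP)
word-of-list {m} zero P sP u bP lP | inj₂ (A , a , C , e) = ⊥-elim (0≢1+n (trans (sym sP) (trans (cong sum e) (sum-step A a C))))
word-of-list {m} (suc n) P sP u bP lP | inj₂ (A , a , C , e)
  with split2 P (length A) (subst (suc (suc (length A)) ≤_) (sym lP) (s≤s A<m))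
  where A<m = length-prefix< A (suc a) 0 C m (trans (cong length (sym e)) (trans (length-lehmer P) lP))
... | PA , p , q , PC , refl , lPA with lehmer-descent PA p q PC A a C lPA e
... | q<p with word-of-list {m} n (PA ++ q ∷ p ∷ PC) (suc-injective (trans (sym (inversions-swap-ascent PA q p PC q<p)) sP))
                 (Unique-resp-↭ (↭-sym swapped) u) (All-resp-↭ (↭-sym swapped) bP) (trans (length-swap-adjacent PA q p p q PC) lP)
  where
  swapped : PA ++ q ∷ p ∷ PC ↭ PA ++ p ∷ q ∷ PC
  swapped = subst (_↭ PA ++ p ∷ q ∷ PC) (swapAt-split PA p q PC) (swapAt-↭ (length PA) (PA ++ p ∷ q ∷ PC))
... | w , P′≡ = fromℕ< A<m ∷ w , sym (wordLine-∷ (fromℕ< A<m) w PA q p PC (sym P′≡) (trans lPA (sym (toℕ-fromℕ< A<m))))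
  where A<m = length-prefix< A (suc a) 0 C m (trans (cong length (sym e)) (trans (length-lehmer P) lP))

lehmer-injective-↭interval : ∀ {m} P Q → P ↭ interval 0 (suc m) → Q ↭ interval 0 (suc m) → lehmer P ≐ lehmer Q → P ≡ Q
lehmer-injective-↭interval P Q pu qu e = lehmer-injective P Q (↭-trans pu (↭-sym qu))
  (≐⇒≡ (lehmer P) (lehmer Q) (trans (length-lehmer P) (trans (↭-length (↭-trans pu (↭-sym qu))) (sym (length-lehmer Q)))) e)

shortWord : ∀ {m} P → P ↭ interval 0 (suc m) → Σ (List (Fin m)) λ w → (wordLine w ≡ P) × (length w ≡ inversions P)
shortWord {m} P p with realize-code {m} (inversions P) (lehmer P) refl (lehmer-isCode P)
                         (trans (length-lehmer P) (trans (↭-length p) (length-interval 0 (suc m))))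
... | w , lehmer≡ , length≡ = w , lehmer-injective-↭interval (wordLine w) P (wordLine-↭ w) p (≡⇒≐ lehmer≡) , length≡


-- The rank criterion

rank : List ℕ → ℕ → ℕ → ℕ
rank P a b = #below b (take a P)

-- The rank criterion for the Bruhat order on one-line notations: P ⊑ Q when Q lies above P.
_⊑_ : List ℕ → List ℕ → Set
P ⊑ Q = ∀ a b → rank Q a b ≤ rank P a b

⊑-refl : ∀ {P} → P ⊑ P
⊑-refl a b = ≤-refl

⊑-trans : ∀ {P Q R} → P ⊑ Q → Q ⊑ R → P ⊑ R
⊑-trans pq qr a b = ≤-trans (qr a b) (pq a b)

take-++-≤ : ∀ (A R : List ℕ) a → a ≤ length A → take a (A ++ R) ≡ take a A
take-++-≤ A R zero _ = refl
take-++-≤ (x ∷ A) R (suc a) (s≤s p) = cong (x ∷_) (take-++-≤ A R a p)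

take-++-+ : ∀ (A R : List ℕ) t → take (length A + t) (A ++ R) ≡ A ++ take t R
take-++-+ [] R t = refl
take-++-+ (x ∷ A) R t = cong (x ∷_) (take-++-+ A R t)

index-cases : ∀ a (A : List ℕ) → (a ≤ length A) ⊎ (∃[ t ] (a ≡ length A + suc t))
index-cases a A with a ≤? length A
... | yes p = inj₁ p
... | no p = inj₂ (proj₁ d , trans (proj₂ d) (sym (+-suc (length A) (proj₁ d))))
  where d = <⇒∃-suc-+ (≰⇒> p)

rank-prefix : ∀ A R R' a b → a ≤ length A → rank (A ++ R) a b ≡ rank (A ++ R') a b
rank-prefix A R R' a b p = cong (#below b) (trans (take-++-≤ A R a p) (sym (take-++-≤ A R' a p)))

rank-length : ∀ A R b → rank (A ++ R) (length A) b ≡ #below b A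
rank-length A R b = cong (#below b) (take-++-length A R)

rank-past : ∀ A x R t b → rank (A ++ x ∷ R) (length A + suc t) b ≡ #below b A + (below x b + #below b (take t R))
rank-past A x R t b = trans (cong (#below b) (take-++-+ A (x ∷ R) (suc t))) (#below-++ b A (x ∷ take t R))

rank-past-swap : ∀ A x y R s b → rank (A ++ x ∷ y ∷ R) (length A + suc (suc s)) b ≡ rank (A ++ y ∷ x ∷ R) (length A + suc (suc s)) b
rank-past-swap A x y R s b rewrite rank-past A x (y ∷ R) (suc s) b | rank-past A y (x ∷ R) (suc s) b =
  cong (#below b A +_) (solve 3 (λ p q r → p :+ (q :+ r) := q :+ (p :+ r)) refl (below x b) (below y b) (#below b (take s R)))

below-antiˡ : ∀ {x x'} b → x ≤ x' → below x' b ≤ below x b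
below-antiˡ {x} {x'} b le with below-cases x' b | below-cases x b
... | inj₁ (p , e1) | inj₁ (q , e2) = ≤-reflexive (trans e1 (sym e2))
... | inj₁ (p , e1) | inj₂ (q , e2) = ⊥-elim (<⇒≱ (≤-<-trans le p) q)
... | inj₂ (p , e1) | _ = subst (_≤ below x b) (sym e1) z≤n

⊑-transpose : ∀ A B C x y → x < y → (A ++ x ∷ B ++ y ∷ C) ⊑ (A ++ y ∷ B ++ x ∷ C)
⊑-transpose A B C x y xy a b with index-cases a A
... | inj₁ p = ≤-reflexive (rank-prefix A _ _ a b p)
... | inj₂ (t , refl) rewrite rank-past A y (B ++ x ∷ C) t b | rank-past A x (B ++ y ∷ C) t b with index-cases t B
... | inj₁ q rewrite take-++-≤ B (x ∷ C) t q | take-++-≤ B (y ∷ C) t q =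
  +-monoʳ-≤ (#below b A) (+-monoˡ-≤ (#below b (take t B)) (below-antiˡ b (<⇒≤ xy)))
... | inj₂ (s , refl) rewrite take-++-+ B (x ∷ C) (suc s) | take-++-+ B (y ∷ C) (suc s) =
  ≤-reflexive (cong (#below b A +_) (#below-swap b y B x (take s C)))

below-lift : ∀ {x y u v b} qa pa → x < y → qa ≤ pa →
  qa + (below x b + (below y b + 0)) ≤ pa + (below u b + (below v b + 0)) →
  qa + (below y b + 0) ≤ pa + (below v b + 0)
below-lift {x} {y} {u} {v} {b} qa pa x<y qa≤pa h with below-cases y b
... | inj₂ (_ , e) rewrite e = +-mono-≤ qa≤pa z≤n
... | inj₁ (y<b , e) rewrite e | below-< {x} {b} (<-trans x<y y<b) =
  ≤-pred (subst₂ _≤_ (solve 1 (λ q → q :+ (con 1 :+ (con 1 :+ con 0)) := con 1 :+ (q :+ (con 1 :+ con 0))) refl qa)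
                     (+-suc pa (below v b + 0))
           (≤-trans h (+-monoʳ-≤ pa (+-monoˡ-≤ (below v b + 0) (below≤1 u b)))))

-- The lifting property: an ascent of the larger list can be swapped together with the
-- corresponding pair of the smaller one.
⊑-swap-adjacent : ∀ PA u v PC QA x y QC → length PA ≡ length QA → x < y →
  (PA ++ u ∷ v ∷ PC) ⊑ (QA ++ x ∷ y ∷ QC) →
  (PA ++ v ∷ u ∷ PC) ⊑ (QA ++ y ∷ x ∷ QC)
⊑-swap-adjacent PA u v PC QA x y QC lq x<y h a b with index-cases a PA
... | inj₁ a≤ = subst₂ _≤_ (rank-prefix QA _ _ a b (subst (a ≤_) lq a≤)) (rank-prefix PA _ _ a b a≤) (h a b)
... | inj₂ (zero , refl) =
  subst₂ _≤_ (sym (onQ (rank-past QA y (x ∷ QC) 0 b))) (sym (rank-past PA v (u ∷ PC) 0 b))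
    (below-lift (#below b QA) (#below b PA) x<y
      (subst₂ _≤_ (trans (cong (λ k → rank _ k b) lq) (rank-length QA _ b)) (rank-length PA _ b) (h (length PA) b))
      (subst₂ _≤_ (onQ (rank-past QA x (y ∷ QC) 1 b)) (rank-past PA u (v ∷ PC) 1 b) (h (length PA + 2) b)))
  where
  onQ : ∀ {R t n} → rank (QA ++ R) (length QA + t) b ≡ n → rank (QA ++ R) (length PA + t) b ≡ n
  onQ {R} {t} = trans (cong (λ k → rank (QA ++ R) (k + t) b) lq)
... | inj₂ (suc s , refl) =
  subst₂ _≤_ (subst (λ k → rank (QA ++ x ∷ y ∷ QC) (k + _) b ≡ rank (QA ++ y ∷ x ∷ QC) (k + _) b) (sym lq)
               (rank-past-swap QA x y QC s b))
             (rank-past-swap PA u v PC s b) (h (length PA + suc (suc s)) b)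

subword⇒⊑ : ∀ {m} (v r : List (Fin m)) → Ascending r → v ⊆ r → wordLine v ⊑ wordLine r
subword⇒⊑ [] [] _ [] = ⊑-refl
subword⇒⊑ v (i ∷ r) (asc , ar) (.i ∷ʳ p) with wordLine-split i r
... | A , a , b , C , e , l = ⊑-trans (subword⇒⊑ v r ar p)
      (subst₂ _⊑_ (sym e) (sym (wordLine-∷ i r A a b C e l)) (⊑-transpose A [] C a b (ascent-values i r asc e l)))
subword⇒⊑ (i ∷ v) (.i ∷ r) (asc , ar) (refl ∷ p) with wordLine-split i r | wordLine-split i v
... | QA , x , y , QC , eq , lq | PA , u , w , PC , ep , lp =
  subst₂ _⊑_ (sym (wordLine-∷ i v PA u w PC ep lp)) (sym (wordLine-∷ i r QA x y QC eq lq))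
    (⊑-swap-adjacent PA u w PC QA x y QC (trans lp (sym lq)) (ascent-values i r asc eq lq)
      (subst₂ _⊑_ ep eq (subword⇒⊑ v r ar p)))

transpose-↭ : ∀ (A B C : List ℕ) x y → (A ++ y ∷ B ++ x ∷ C) ↭ (A ++ x ∷ B ++ y ∷ C)
transpose-↭ A B C x y = ++⁺ˡ A (↭-trans (↭-prep y (shift x B C)) (↭-trans (↭-swap y x (↭-refl {xs = B ++ C})) (↭-prep x (↭-sym (shift y B C)))))

UpSwap : List ℕ → List ℕ → Set
UpSwap P P' = Σ (List ℕ) λ A → Σ (List ℕ) λ B → Σ (List ℕ) λ C → Σ ℕ λ x → Σ ℕ λ y →
  (P ≡ A ++ x ∷ B ++ y ∷ C) × (P' ≡ A ++ y ∷ B ++ x ∷ C) × (x < y) × NoneBetween B x y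

Σ< : ℕ → (ℕ → ℕ) → ℕ
Σ< zero f = 0
Σ< (suc n) f = f n + Σ< n f

Σ<-mono : ∀ n f g → (∀ k → k < n → f k ≤ g k) → Σ< n f ≤ Σ< n g
Σ<-mono zero f g h = z≤n
Σ<-mono (suc n) f g h = +-mono-≤ (h n ≤-refl) (Σ<-mono n f g (λ k p → h k (m≤n⇒m≤1+n p)))

Σ<-strict : ∀ n f g → (∀ k → k < n → f k ≤ g k) → ∀ k0 → k0 < n → f k0 < g k0 → Σ< n f < Σ< n g
Σ<-strict (suc n) f g h k0 kp lt with k0 ≟ n
... | yes refl = +-mono-<-≤ lt (Σ<-mono n f g (λ k p → h k (m≤n⇒m≤1+n p)))
... | no ne = +-mono-≤-< (h n ≤-refl) (Σ<-strict n f g (λ k p → h k (m≤n⇒m≤1+n p)) k0 (≤∧≢⇒< (≤-pred kp) ne) lt)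

rankSum : ℕ → List ℕ → ℕ
rankSum N X = Σ< (suc N) (λ a → Σ< (suc N) (λ b → rank X a b))

rankSum-strict : ∀ N P Q → P ⊑ Q → ∀ a0 b0 → a0 < suc N → b0 < suc N → rank Q a0 b0 < rank P a0 b0 → rankSum N Q < rankSum N P
rankSum-strict N P Q h a0 b0 pa pb lt = Σ<-strict (suc N) _ _ (λ a _ → Σ<-mono (suc N) _ _ (λ b _ → h a b)) a0 pa
  (Σ<-strict (suc N) _ _ (λ b _ → h a0 b) b0 pb lt)

rankSum-transpose : ∀ N A B C {p q} → p < q → All (_< N) (A ++ p ∷ B ++ q ∷ C) → length (A ++ p ∷ B ++ q ∷ C) ≡ N →
  rankSum N (A ++ q ∷ B ++ p ∷ C) < rankSum N (A ++ p ∷ B ++ q ∷ C)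
rankSum-transpose N A B C {p} {q} p<q bounded lP =
  rankSum-strict N _ _ (⊑-transpose A B C p q p<q) (length A + 1) q a<N q<N lt
  where
  a<N : length A + 1 < suc N
  a<N = s≤s (subst (length A + 1 ≤_) (trans (sym (length-++ A)) lP) (+-monoʳ-≤ (length A) (s≤s z≤n)))
  q<N : q < suc N
  q<N = m≤n⇒m≤1+n (All.lookup bounded (∈-++⁺ʳ A (there (∈-++⁺ʳ B (here refl)))))
  lt : rank (A ++ q ∷ B ++ p ∷ C) (length A + 1) q < rank (A ++ p ∷ B ++ q ∷ C) (length A + 1) q
  lt rewrite rank-past A q (B ++ p ∷ C) 0 q | rank-past A p (B ++ q ∷ C) 0 q | below-≥ {q} {q} ≤-refl | below-< p<q =
    +-monoʳ-< (#below q A) (s≤s z≤n)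

firstDifference : ∀ P Q → length P ≡ length Q → (P ≡ Q) ⊎
  (Σ (List ℕ) λ A → Σ ℕ λ p → Σ (List ℕ) λ P2 → Σ ℕ λ q0 → Σ (List ℕ) λ D →
     (P ≡ A ++ p ∷ P2) × (Q ≡ A ++ q0 ∷ D) × (p ≢ q0))
firstDifference [] [] _ = inj₁ refl
firstDifference (p ∷ P) (q ∷ Q) l with p ≟ q
... | no ne = inj₂ ([] , p , P , q , Q , refl , refl , ne)
... | yes refl with firstDifference P Q (suc-injective l)
... | inj₁ refl = inj₁ refl
... | inj₂ (A , p' , P2 , q0 , D , e1 , e2 , ne) = inj₂ (p ∷ A , p' , P2 , q0 , D , cong (p ∷_) e1 , cong (p ∷_) e2 , ne)

⊑-first-difference : ∀ A p P2 q0 D → (A ++ p ∷ P2) ⊑ (A ++ q0 ∷ D) → p ≢ q0 → p < q0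
⊑-first-difference A p P2 q0 D h p≢q0 with <-cmp p q0
... | tri< p<q0 _ _ = p<q0
... | tri≈ _ p≡q0 _ = ⊥-elim (p≢q0 p≡q0)
... | tri> _ _ q0<p = ⊥-elim (<⇒≱ bad (h (length A + 1) p))
  where
  bad : rank (A ++ p ∷ P2) (length A + 1) p < rank (A ++ q0 ∷ D) (length A + 1) p
  bad rewrite rank-past A p P2 0 p | rank-past A q0 D 0 p | below-≥ {p} {p} ≤-refl | below-< q0<p = +-monoʳ-< (#below p A) (s≤s z≤n)

↭-first-difference : ∀ A p P2 q0 D → (A ++ p ∷ P2) ↭ (A ++ q0 ∷ D) → Unique (A ++ p ∷ P2) → p ≢ q0 → q0 ∈ P2
↭-first-difference A p P2 q0 D pq u p≢q0 with ∈-++⁻ A (∈-resp-↭ (↭-sym pq) (∈-++⁺ʳ A (here refl)))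
... | inj₁ q0∈A = ⊥-elim (Unique-middle A (Unique-resp-↭ pq u) q0∈A)
... | inj₂ (here q0≡p) = ⊥-elim (p≢q0 (sym q0≡p))
... | inj₂ (there q0∈P2) = q0∈P2

InRange : ℕ → ℕ → ℕ → Set
InRange lo hi z = (lo < z) × (z ≤ hi)

inRange? : ∀ lo hi z → Dec (InRange lo hi z)
inRange? lo hi z with lo <? z | z ≤? hi
... | yes p | yes q = yes (p , q)
... | no p | _ = no (λ r → p (proj₁ r))
... | yes _ | no q = no (λ r → q (proj₂ r))

firstInRange : ∀ lo hi Z z → z ∈ Z → InRange lo hi z →
  Σ (List ℕ) λ B → Σ ℕ λ q → Σ (List ℕ) λ C → (Z ≡ B ++ q ∷ C) × All (λ b → ¬ InRange lo hi b) B × InRange lo hi q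
firstInRange lo hi (x ∷ Z) z m r with inRange? lo hi x
... | yes rx = [] , x , Z , refl , [] , rx
... | no rx with m
... | here refl = ⊥-elim (rx r)
... | there m' with firstInRange lo hi Z z m' r
... | B , q , C , e , nb , rq = x ∷ B , q , C , cong (x ∷_) e , rx ∷ nb , rq

noneBetween-outside : ∀ B {p q q0} → q ≤ q0 → p ∉ B → All (λ b → ¬ InRange p q0 b) B → NoneBetween B p q
noneBetween-outside [] _ _ [] = []
noneBetween-outside (b ∷ B) {p} {q} {q0} q≤q0 p∉ (r ∷ rs) = hd ∷ noneBetween-outside B q≤q0 (λ m → p∉ (there m)) rs
  where
  hd : b < p ⊎ q < b
  hd with b <? p | p <? b
  ... | yes b<p | _ = inj₁ b<p
  ... | no b≮p | no p≮b = ⊥-elim (p∉ (here (sym (≤-antisym (≮⇒≥ p≮b) (≮⇒≥ b≮p)))))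
  ... | no _ | yes p<b with b ≤? q0
  ... | yes b≤q0 = ⊥-elim (r (p<b , b≤q0))
  ... | no b≰q0 = inj₂ (≤-<-trans q≤q0 (≰⇒> b≰q0))

below-outside : ∀ b p q → p < q → ¬ InRange p q b → below q b ≡ below p b
below-outside b p q pq nr with p <? b
... | no pb = trans (below-≥ {q} {b} (≤-trans (≮⇒≥ pb) (<⇒≤ pq))) (sym (below-≥ {p} {b} (≮⇒≥ pb)))
... | yes pb with b ≤? q
... | yes bq = ⊥-elim (nr (pb , bq))
... | no bq = trans (below-< (≰⇒> bq)) (sym (below-< pb))

below-threshold-outside : ∀ {p q0 b} b' → p < b → b ≤ q0 → ¬ InRange p q0 b' → below b' (suc q0) ≡ below b' b
below-threshold-outside {p} {q0} {b} b' p<b b≤q0 nr with p <? b'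
... | no p≮b' = trans (below-< (s≤s (≤-trans (≮⇒≥ p≮b') (<⇒≤ (<-≤-trans p<b b≤q0))))) (sym (below-< (≤-<-trans (≮⇒≥ p≮b') p<b)))
... | yes p<b' with b' ≤? q0
... | yes b'≤q0 = ⊥-elim (nr (p<b' , b'≤q0))
... | no b'≰q0 = trans (below-≥ (≰⇒> b'≰q0)) (sym (below-≥ (≤-trans b≤q0 (<⇒≤ (≰⇒> b'≰q0)))))

-- The rank of the upper list at threshold b is compared through its rank at threshold q0 + 1,
-- at which the entries of B, lying outside (p, q0], count exactly as at threshold b.
rank-inside : ∀ A B C D {p q q0 b} t → t ≤ length B → p < q → q ≤ q0 → p < b → b ≤ q →
  All (λ b' → ¬ InRange p q0 b') B → (A ++ p ∷ B ++ q ∷ C) ⊑ (A ++ q0 ∷ D) →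
  rank (A ++ q0 ∷ D) (length A + suc t) b ≤ rank (A ++ q ∷ B ++ p ∷ C) (length A + suc t) b
rank-inside A B C D {p} {q} {q0} {b} t t≤B p<q q≤q0 p<b b≤q outside h =
  subst₂ _≤_ (sym (rank-past A q0 D t b)) (sym rank-P′) goal
  where
  rank-P′ : rank (A ++ q ∷ B ++ p ∷ C) (length A + suc t) b ≡ #below b A + (below q b + #below b (take t B))
  rank-P′ = trans (rank-past A q (B ++ p ∷ C) t b) (cong (λ z → #below b A + (below q b + #below b z)) (take-++-≤ B (p ∷ C) t t≤B))
  at-q0+1 : #below (suc q0) A + (below q0 (suc q0) + #below (suc q0) (take t D))
          ≤ #below (suc q0) A + (below p (suc q0) + #below (suc q0) (take t B))
  at-q0+1 = subst₂ _≤_ (rank-past A q0 D t (suc q0))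
              (trans (rank-past A p (B ++ q ∷ C) t (suc q0))
                     (cong (λ z → #below (suc q0) A + (below p (suc q0) + #below (suc q0) z)) (take-++-≤ B (q ∷ C) t t≤B)))
              (h (length A + suc t) (suc q0))
  D≤B : #below (suc q0) (take t D) ≤ #below (suc q0) (take t B)
  D≤B = +-cancelˡ-≤ 1 _ _ (subst₂ _≤_ (cong (_+ #below (suc q0) (take t D)) (below-< (≤-refl {suc q0})))
                                     (cong (_+ #below (suc q0) (take t B)) (below-< (s≤s (<⇒≤ (<-≤-trans p<q q≤q0)))))
           (+-cancelˡ-≤ (#below (suc q0) A) _ _ at-q0+1))
  goal : #below b A + (below q0 b + #below b (take t D)) ≤ #below b A + (below q b + #below b (take t B))
  goal rewrite below-≥ {q0} {b} (≤-trans b≤q q≤q0) | below-≥ {q} {b} b≤q =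
    +-monoʳ-≤ (#below b A) (≤-trans (#below-mono (take t D) (≤-trans (≤-trans b≤q q≤q0) (n≤1+n q0)))
      (≤-trans D≤B (≤-reflexive (#below-cong (take t B)
        (All.map (λ {b'} → below-threshold-outside b' p<b (≤-trans b≤q q≤q0)) (take⁺ t outside))))))

⊑-toward : ∀ A B C D {p q q0} → p < q → q ≤ q0 → All (λ b' → ¬ InRange p q0 b') B →
  (A ++ p ∷ B ++ q ∷ C) ⊑ (A ++ q0 ∷ D) → (A ++ q ∷ B ++ p ∷ C) ⊑ (A ++ q0 ∷ D)
⊑-toward A B C D {p} {q} {q0} p<q q≤q0 outside h a b with index-cases a A
... | inj₁ a≤A = subst (_ ≤_) (rank-prefix A (p ∷ B ++ q ∷ C) (q ∷ B ++ p ∷ C) a b a≤A) (h a b)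
... | inj₂ (t , refl) with index-cases t B
... | inj₂ (s , refl) = subst (_ ≤_) same (h (length A + suc (length B + suc s)) b)
  where
  same : rank (A ++ p ∷ B ++ q ∷ C) (length A + suc (length B + suc s)) b ≡ rank (A ++ q ∷ B ++ p ∷ C) (length A + suc (length B + suc s)) b
  same rewrite rank-past A p (B ++ q ∷ C) (length B + suc s) b | rank-past A q (B ++ p ∷ C) (length B + suc s) b
    | take-++-+ B (q ∷ C) (suc s) | take-++-+ B (p ∷ C) (suc s) = cong (#below b A +_) (#below-swap b p B q (take s C))
... | inj₁ t≤B with inRange? p q b
... | yes (p<b , b≤q) = rank-inside A B C D t t≤B p<q q≤q0 p<b b≤q outside h
... | no b∉ = subst (_ ≤_) same (h (length A + suc t) b)
  where
  same : rank (A ++ p ∷ B ++ q ∷ C) (length A + suc t) b ≡ rank (A ++ q ∷ B ++ p ∷ C) (length A + suc t) b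
  same rewrite rank-past A p (B ++ q ∷ C) t b | rank-past A q (B ++ p ∷ C) t b
    | take-++-≤ B (q ∷ C) t t≤B | take-++-≤ B (p ∷ C) t t≤B = cong (λ z → #below b A + (z + #below b (take t B))) (sym (below-outside b p q p<q b∉))

-- Where P and Q first differ, P has the smaller entry p; exchanging p with the first later
-- entry q in (p, q0] is a cover of P that stays below Q.
upSwap-towards : ∀ N A p P2 q0 D → p ≢ q0 → (A ++ p ∷ P2) ⊑ (A ++ q0 ∷ D) → (A ++ p ∷ P2) ↭ (A ++ q0 ∷ D) →
  Unique (A ++ p ∷ P2) → All (_< N) (A ++ p ∷ P2) → length (A ++ p ∷ P2) ≡ N →
  Σ (List ℕ) λ P' → UpSwap (A ++ p ∷ P2) P' × (P' ⊑ (A ++ q0 ∷ D)) × (rankSum N P' < rankSum N (A ++ p ∷ P2)) × (P' ↭ (A ++ p ∷ P2))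
upSwap-towards N A p P2 q0 D p≢q0 h pq u bounded lP
  with firstInRange p q0 P2 q0 (↭-first-difference A p P2 q0 D pq u p≢q0) (⊑-first-difference A p P2 q0 D h p≢q0 , ≤-refl)
... | B , q , C , refl , outside , (p<q , q≤q0) =
  A ++ q ∷ B ++ p ∷ C , (A , B , C , p , q , refl , refl , p<q , gap) ,
  ⊑-toward A B C D p<q q≤q0 outside h , rankSum-transpose N A B C p<q bounded lP , transpose-↭ A B C p q
  where
  gap : NoneBetween B p q
  gap = noneBetween-outside B q≤q0 (λ p∈B → Unique[x∷xs]⇒x∉xs (Unique-++⁻ʳ A u) (∈-++⁺ˡ p∈B)) outside

-- Induction on rankSum, which strictly decreases along each step.
⊑⇒UpSwap* : ∀ N n P Q → rankSum N P ≤ n → P ↭ Q → Unique P → All (_< N) P → length P ≡ N → P ⊑ Q → Star UpSwap P Q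
⊑⇒UpSwap* N n P Q hm pq d b l h with firstDifference P Q (↭-length pq)
... | inj₁ refl = ε
... | inj₂ (A , p , P2 , q0 , D , refl , refl , ne) with upSwap-towards N A p P2 q0 D ne h pq d b l
... | P' , step , up , mlt , perm' with n
... | zero = ⊥-elim (<⇒≱ (<-≤-trans mlt hm) z≤n)
... | suc n' = step ◅ ⊑⇒UpSwap* N n' P' (A ++ q0 ∷ D) (≤-pred (<-≤-trans mlt hm)) (↭-trans perm' pq)
      (Unique-resp-↭ (↭-sym perm') d) (All-resp-↭ (↭-sym perm') b) (trans (↭-length perm') l) up


wordLine-⊑⇒UpSwap* : ∀ {m} (v r : List (Fin m)) → wordLine v ⊑ wordLine r → Star UpSwap (wordLine v) (wordLine r)
wordLine-⊑⇒UpSwap* {m} v r = ⊑⇒UpSwap* (suc m) _ (wordLine v) (wordLine r) ≤-refl (↭-trans (wordLine-↭ v) (↭-sym (wordLine-↭ r)))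
  (wordLine-unique v) (wordLine-bounded v) (length-wordLine v)


-- Deleting a letter

data Before (x y : ℕ) : List ℕ → Set where
  bhere : ∀ {P} → y ∈ P → Before x y (x ∷ P)
  bthere : ∀ {z P} → z ≢ y → Before x y P → Before x y (z ∷ P)

Before-x∈ : ∀ {x y P} → Before x y P → x ∈ P
Before-x∈ (bhere _) = here refl
Before-x∈ (bthere _ b) = there (Before-x∈ b)

Before-y∈ : ∀ {x y P} → Before x y P → y ∈ P
Before-y∈ (bhere m) = there m
Before-y∈ (bthere _ b) = there (Before-y∈ b)

before? : ∀ x y P → Dec (Before x y P)
before? x y [] = no (λ ())
before? x y (z ∷ P) with z ≟ x
before? x y (.x ∷ P) | yes refl with y ∈? P
... | yes m = yes (bhere m)
... | no nm = no (λ { (bhere m) → nm m ; (bthere _ b) → nm (Before-y∈ b) })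
before? x y (z ∷ P) | no zx with z ≟ y
... | yes zy = no (λ { (bhere _) → zx refl ; (bthere ne _) → ne zy })
... | no zy with before? x y P
... | yes b = yes (bthere zy b)
... | no nb = no (λ { (bhere _) → zx refl ; (bthere _ b) → nb b })

abstract
  swapValues : ℕ → ℕ → ℕ → ℕ
  swapValues x y z with z ≟ x
  ... | yes _ = y
  ... | no _ with z ≟ y
  ... | yes _ = x
  ... | no _ = z

  swapValues-x : ∀ x y → swapValues x y x ≡ y
  swapValues-x x y with x ≟ x
  ... | yes _ = refl
  ... | no n = ⊥-elim (n refl)

  swapValues-y : ∀ x y → x ≢ y → swapValues x y y ≡ x
  swapValues-y x y ne with y ≟ x
  ... | yes e = ⊥-elim (ne (sym e))
  ... | no _ with y ≟ y
  ... | yes _ = refl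
  ... | no n = ⊥-elim (n refl)

  swapValues-other : ∀ x y z → z ≢ x → z ≢ y → swapValues x y z ≡ z
  swapValues-other x y z n1 n2 with z ≟ x
  ... | yes e = ⊥-elim (n1 e)
  ... | no _ with z ≟ y
  ... | yes e = ⊥-elim (n2 e)
  ... | no _ = refl

  swapValues-involutive : ∀ x y z → swapValues x y (swapValues x y z) ≡ z
  swapValues-involutive x y z with z ≟ x
  swapValues-involutive x y z | yes refl with y ≟ z
  ... | yes refl = refl
  ... | no n with y ≟ y
  ... | yes _ = refl
  ... | no n' = ⊥-elim (n' refl)
  swapValues-involutive x y z | no zx with z ≟ y
  swapValues-involutive x y z | no zx | yes refl with x ≟ x
  ... | yes _ = refl
  ... | no n = ⊥-elim (n refl)
  swapValues-involutive x y z | no zx | no zy with z ≟ x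
  ... | yes e = ⊥-elim (zx e)
  ... | no _ with z ≟ y
  ... | yes e = ⊥-elim (zy e)
  ... | no _ = refl

map-swapValues² : ∀ x y P → map (swapValues x y) (map (swapValues x y) P) ≡ P
map-swapValues² x y [] = refl
map-swapValues² x y (z ∷ P) = cong₂ _∷_ (swapValues-involutive x y z) (map-swapValues² x y P)

map-swapValues-fresh : ∀ x y Q → x ∉ Q → y ∉ Q → map (swapValues x y) Q ≡ Q
map-swapValues-fresh x y [] _ _ = refl
map-swapValues-fresh x y (z ∷ Q) nx ny = cong₂ _∷_ (swapValues-other x y z (λ e → nx (here (sym e))) (λ e → ny (here (sym e))))
  (map-swapValues-fresh x y Q (λ m → nx (there m)) (λ m → ny (there m)))

∈-swapAt : ∀ {y} i P → y ∈ P → y ∈ swapAt i P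
∈-swapAt i P m = ∈-resp-↭ (↭-sym (swapAt-↭ i P)) m

swapAt≡swapValues : ∀ x y i P → x ≢ y → Unique P → Before x y P → ¬ Before x y (swapAt i P) → swapAt i P ≡ map (swapValues x y) P
swapAt≡swapValues x y zero [] xy d b nb = ⊥-elim (nb b)
swapAt≡swapValues x y zero (a ∷ []) xy d b nb = ⊥-elim (nb b)
swapAt≡swapValues x y zero (.x ∷ b ∷ Q) xy (x∉ ∷ b∉ ∷ _) (bhere m) nb with b ≟ y
... | yes refl = trans (cong₂ (λ u v → u ∷ v ∷ Q) (sym (swapValues-x x y)) (sym (swapValues-y x y xy)))
        (cong (λ R → swapValues x y x ∷ swapValues x y y ∷ R) (sym (map-swapValues-fresh x y Q (All¬⇒¬Any (All.tail x∉)) (All¬⇒¬Any b∉))))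
... | no by = ⊥-elim (nb (bthere by (bhere (tl m))))
  where tl : y ∈ b ∷ Q → y ∈ Q
        tl (here e) = ⊥-elim (by (sym e))
        tl (there m') = m'
swapAt≡swapValues x y zero (a ∷ b ∷ Q) xy d (bthere ay (bhere m)) nb = ⊥-elim (nb (bhere (there m)))
swapAt≡swapValues x y zero (a ∷ b ∷ Q) xy d (bthere ay (bthere by bq)) nb = ⊥-elim (nb (bthere by (bthere ay bq)))
swapAt≡swapValues x y (suc i) [] xy d b nb = ⊥-elim (nb b)
swapAt≡swapValues x y (suc i) (.x ∷ P) xy d (bhere m) nb = ⊥-elim (nb (bhere (∈-swapAt i P m)))
swapAt≡swapValues x y (suc i) (a ∷ P) xy (na ∷ d) (bthere ay b) nb =
  cong₂ _∷_ (sym (swapValues-other x y a ax ay)) (swapAt≡swapValues x y i P xy d b (λ b' → nb (bthere ay b')))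
  where ax : a ≢ x
        ax refl = All¬⇒¬Any na (Before-x∈ b)

before-interval : ∀ s n x y → s ≤ x → x < y → y < s + n → Before x y (interval s n)
before-interval s zero x y sx xy yn = ⊥-elim (<⇒≱ (<-trans xy yn) (subst (_≤ x) (sym (+-identityʳ s)) sx))
before-interval s (suc n) x y sx xy yn with s ≟ x
... | yes refl = bhere (interval-∈ (suc s) n y xy (subst (y <_) (+-suc s n) yn))
... | no ne = bthere (λ e → <⇒≢ (≤-<-trans sx xy) e) (before-interval (suc s) n x y (≤∧≢⇒< sx ne) xy (subst (y <_) (+-suc s n) yn))

-- Deleting the letter after which x no longer precedes y exchanges the values x and y, since
-- swapping positions commutes with relabelling values.
unswap-subword : ∀ {m} x y → x < y → y < suc m → (v : List (Fin m)) → ¬ Before x y (wordLine v) →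
  Σ (List (Fin m)) λ v' → (v' ⊆ v) × (wordLine v' ≡ map (swapValues x y) (wordLine v))
unswap-subword {m} x y xy ym [] nb = ⊥-elim (nb (before-interval 0 (suc m) x y z≤n xy ym))
unswap-subword {m} x y xy ym (i ∷ w) nb with before? x y (wordLine w)
... | yes b = w , (i ∷ʳ ⊆-refl) ,
      sym (trans (cong (map (swapValues x y)) (swapAt≡swapValues x y (toℕ i) (wordLine w) (<⇒≢ xy) (wordLine-unique w) b nb))
                 (map-swapValues² x y (wordLine w)))
... | no nb' with unswap-subword x y xy ym w nb'
... | w' , p , e = i ∷ w' , (refl ∷ p) , trans (cong (swapAt (toℕ i)) e) (swapAt-map (swapValues x y) (toℕ i) (wordLine w))

¬Before : ∀ A x y Z → x < y → x ∉ A → ¬ Before x y (A ++ y ∷ Z)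
¬Before [] x .x Z xy nx (bhere _) = <-irrefl refl xy
¬Before [] x y Z xy nx (bthere ne _) = ne refl
¬Before (a ∷ A) .a y Z xy nx (bhere _) = nx (here refl)
¬Before (a ∷ A) x y Z xy nx (bthere _ b) = ¬Before A x y Z xy (λ m → nx (there m)) b

map-swapValues-transposition : ∀ A B C {x y} → x ≢ y → Unique (A ++ y ∷ B ++ x ∷ C) →
  map (swapValues x y) (A ++ y ∷ B ++ x ∷ C) ≡ A ++ x ∷ B ++ y ∷ C
map-swapValues-transposition A B C {x} {y} x≢y u =
  begin
    map (swapValues x y) (A ++ y ∷ B ++ x ∷ C)
  ≡⟨ map-++ (swapValues x y) A (y ∷ B ++ x ∷ C) ⟩
    map (swapValues x y) A ++ swapValues x y y ∷ map (swapValues x y) (B ++ x ∷ C)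
  ≡⟨ cong (λ R → map (swapValues x y) A ++ swapValues x y y ∷ R) (map-++ (swapValues x y) B (x ∷ C)) ⟩
    map (swapValues x y) A ++ swapValues x y y ∷ map (swapValues x y) B ++ swapValues x y x ∷ map (swapValues x y) C
  ≡⟨ cong₂ (λ A′ R → A′ ++ swapValues x y y ∷ R)
       (map-swapValues-fresh x y A (Unique-disjoint A u (there (∈-++⁺ʳ B (here refl)))) (Unique-disjoint A u (here refl)))
       (cong₂ (λ B′ C′ → B′ ++ swapValues x y x ∷ C′)
         (map-swapValues-fresh x y B (Unique-middle B (AllPairs.tail uy)) (λ m → Unique[x∷xs]⇒x∉xs uy (∈-++⁺ˡ m)))
         (map-swapValues-fresh x y C (Unique[x∷xs]⇒x∉xs ux) (λ m → Unique[x∷xs]⇒x∉xs uy (∈-++⁺ʳ B (there m))))) ⟩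
    A ++ swapValues x y y ∷ B ++ swapValues x y x ∷ C
  ≡⟨ cong₂ (λ a b → A ++ a ∷ B ++ b ∷ C) (swapValues-y x y x≢y) (swapValues-x x y) ⟩
    A ++ x ∷ B ++ y ∷ C
  ∎
  where
  open ≡-Reasoning
  uy : Unique (y ∷ B ++ x ∷ C)
  uy = Unique-++⁻ʳ A u
  ux : Unique (x ∷ C)
  ux = Unique-++⁻ʳ B (AllPairs.tail uy)

upSwap-subword : ∀ {m} (v : List (Fin m)) A B C x y → x < y → wordLine v ≡ A ++ y ∷ B ++ x ∷ C →
  Σ (List (Fin m)) λ v' → (v' ⊆ v) × (wordLine v' ≡ A ++ x ∷ B ++ y ∷ C)
upSwap-subword {m} v A B C x y x<y e with unswap-subword x y x<y y<1+m v ¬before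
  where
  u : Unique (A ++ y ∷ B ++ x ∷ C)
  u = subst Unique e (wordLine-unique v)
  y<1+m : y < suc m
  y<1+m = interval-< 0 (suc m) y (∈-resp-↭ (wordLine-↭ v) (subst (y ∈_) (sym e) (∈-++⁺ʳ A (here refl))))
  ¬before : ¬ Before x y (wordLine v)
  ¬before b = ¬Before A x y (B ++ x ∷ C) x<y (Unique-disjoint A u (there (∈-++⁺ʳ B (here refl)))) (subst (Before x y) e b)
... | v' , v'⊆v , e' = v' , v'⊆v ,
  trans e' (trans (cong (map (swapValues x y)) e) (map-swapValues-transposition A B C (<⇒≢ x<y) (subst Unique e (wordLine-unique v))))


-- Chains of covers

-- Dropping the last entry of the Lehmer code of a list of length m + 1 loses nothing: it is 0.
shortLehmer : ℕ → List ℕ → List ℕ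
shortLehmer m X = take m (lehmer X)

get-take : ∀ m (C : List ℕ) k → k < m → get (take m C) k ≡ get C k
get-take (suc m) [] k _ = refl
get-take (suc m) (x ∷ C) zero _ = refl
get-take (suc m) (x ∷ C) (suc k) (s≤s p) = get-take m C k p

get-take-≥ : ∀ m (C : List ℕ) k → m ≤ k → get (take m C) k ≡ 0
get-take-≥ zero C k _ = refl
get-take-≥ (suc m) [] k _ = refl
get-take-≥ (suc m) (x ∷ C) (suc k) (s≤s p) = get-take-≥ m C k p

shortLehmer≐lehmer : ∀ m X → length X ≡ suc m → shortLehmer m X ≐ lehmer X
shortLehmer≐lehmer m X l = mk≐ same
  where
  same : ∀ k → get (shortLehmer m X) k ≡ get (lehmer X) k
  same k with k <? m
  ... | yes p = get-take m (lehmer X) k p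
  ... | no p = trans (get-take-≥ m (lehmer X) k (≮⇒≥ p)) (sym (trans (get-lehmer X k)
      (cong (#below (get X k)) (drop-all (suc k) X (subst (_≤ suc k) (sym l) (s≤s (≮⇒≥ p)))))))

shortLehmer-InC : ∀ m X → length X ≡ suc m → InC m (shortLehmer m X)
shortLehmer-InC m X l = trans (length-take m (lehmer X)) (m≤n⇒m⊓n≡m (subst (m ≤_) (sym (trans (length-lehmer X) l)) (n≤1+n m))) , bnd
  where
  bnd : ∀ i → 1 ≤ i → i ≤ m → shortLehmer m X ‼ i ≤ suc m ∸ i
  bnd (suc k) _ km = subst (_≤ suc m ∸ suc k) (sym (trans (get-take m (lehmer X) k km) (get-lehmer X k)))
    (subst (#below (get X k) (drop (suc k) X) ≤_) (trans (length-drop (suc k) X) (cong (_∸ suc k) l)) (#below≤length (get X k) (drop (suc k) X)))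

UpSwap*⇒CoverStep* : ∀ {m} P Q → P ↭ interval 0 (suc m) → Star UpSwap P Q → Star (CoverStep m) (shortLehmer m P) (shortLehmer m Q)
UpSwap*⇒CoverStep* P .P pu ε = ε
UpSwap*⇒CoverStep* {m} P Q pu (_◅_ {j = P'} (A , B , C , x , y , refl , refl , xy , nm) rest) =
  (shortLehmer-InC m P lP , shortLehmer-InC m P' lP' ,
   Covers-resp (≐-sym (shortLehmer≐lehmer m P' lP')) (≐-sym (shortLehmer≐lehmer m P lP)) (Transposition.covers A B C xy nm))
  ◅ UpSwap*⇒CoverStep* P' Q pu' rest
  where
  pu' : P' ↭ interval 0 (suc m)
  pu' = ↭-trans (transpose-↭ A B C x y) pu
  lP : length P ≡ suc m
  lP = trans (↭-length pu) (length-interval 0 (suc m))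
  lP' : length P' ≡ suc m
  lP' = trans (↭-length pu') (length-interval 0 (suc m))

-- Walking a chain of covers down from the code of wordLine r, each cover removes a letter.
CoverStep*⇒subword : ∀ {m} (r : List (Fin m)) β γ → Star (CoverStep m) β γ → lehmer (wordLine r) ≐ γ →
  Σ (List (Fin m)) λ v → (v ⊆ r) × (lehmer (wordLine v) ≐ β)
CoverStep*⇒subword r β .β ε e = r , ⊆-refl , e
CoverStep*⇒subword r β γ (_◅_ {j = δ} (_ , _ , cov) rest) e with CoverStep*⇒subword r δ γ rest e
... | vδ , vδ⊆r , eδ with Covers⇒transposition (wordLine vδ) β (wordLine-unique vδ) (Covers-resp (≐-sym eδ) (≡⇒≐ refl) cov)
... | A , B , C , x , y , eq , x<y , _ , β≈ with upSwap-subword vδ A B C x y x<y eq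
... | v , v⊆vδ , e′ = v , ⊆-trans v⊆vδ vδ⊆r , ≐-trans (≡⇒≐ (cong lehmer e′)) (≐-sym β≈)


-- Permutations

swapFin : ∀ {m} → Fin m → Fin (suc m) → Fin (suc m)
swapFin i = PC.transpose (fsuc i) (inject₁ i)

swapFin-suc : ∀ {m} (i : Fin m) k → swapFin (fsuc i) (fsuc k) ≡ fsuc (swapFin i k)
swapFin-suc i k with does (k Fin.≟ fsuc i)
... | true = refl
... | false with does (k Fin.≟ inject₁ i)
... | true = refl
... | false = refl

tabulate-injective : ∀ {n} (g h : Fin n → ℕ) → tabulate g ≡ tabulate h → ∀ k → g k ≡ h k
tabulate-injective {suc n} g h e fzero = proj₁ (∷-injective e)
tabulate-injective {suc n} g h e (fsuc k) = tabulate-injective (λ k → g (fsuc k)) (λ k → h (fsuc k)) (proj₂ (∷-injective e)) k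

tabulate-swapAt : ∀ {m} (i : Fin m) (f : Fin (suc m) → ℕ) → tabulate (λ k → f (swapFin i k)) ≡ swapAt (toℕ i) (tabulate f)
tabulate-swapAt {suc m} fzero f = refl
tabulate-swapAt {suc m} (fsuc i) f = cong (f fzero ∷_)
  (trans (tabulate-cong (λ k → cong f (swapFin-suc i k)))
         (tabulate-swapAt i (λ k → f (fsuc k))))

tabulate-interval : ∀ n s → tabulate {n = n} (λ k → s + toℕ k) ≡ interval s n
tabulate-interval zero s = refl
tabulate-interval (suc n) s = cong₂ _∷_ (+-identityʳ s)
  (trans (tabulate-cong (λ k → +-suc s (toℕ k))) (tabulate-interval n (suc s)))

-- The values π⁻¹(0), …, π⁻¹(m): with the composition order used by prod, the letters of a
-- word act on this list by swapping positions.
oneLine : ∀ {m} → Permutation′ (suc m) → List ℕ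
oneLine π = tabulate (λ k → toℕ (π ⟨$⟩ˡ k))

oneLine-prod : ∀ {m} (w : List (Fin m)) → oneLine (prod w) ≡ wordLine w
oneLine-prod {m} [] = tabulate-interval (suc m) 0
oneLine-prod {m} (i ∷ w) = trans (tabulate-swapAt i (λ k → toℕ (prod w ⟨$⟩ˡ k))) (cong (swapAt (toℕ i)) (oneLine-prod w))

oneLine-cong : ∀ {m} (π σ : Permutation′ (suc m)) → π ≈ σ → oneLine π ≡ oneLine σ
oneLine-cong π σ e = tabulate-cong (λ k → cong toℕ (h k))
  where
  h : ∀ k → π ⟨$⟩ˡ k ≡ σ ⟨$⟩ˡ k
  h k = trans (cong (π ⟨$⟩ˡ_) (sym (inverseʳ σ))) (trans (cong (π ⟨$⟩ˡ_) (sym (e (σ ⟨$⟩ˡ k)))) (inverseˡ π))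

oneLine-injective : ∀ {m} (π σ : Permutation′ (suc m)) → oneLine π ≡ oneLine σ → π ≈ σ
oneLine-injective π σ e i = trans (cong (π ⟨$⟩ʳ_) (sym (inverseˡ σ))) (trans (cong (π ⟨$⟩ʳ_) (sym (hl (σ ⟨$⟩ʳ i)))) (inverseʳ π))
  where
  hl : ∀ k → π ⟨$⟩ˡ k ≡ σ ⟨$⟩ˡ k
  hl k = toℕ-injective (tabulate-injective (λ k → toℕ (π ⟨$⟩ˡ k)) (λ k → toℕ (σ ⟨$⟩ˡ k)) e k)

oneLine-unique : ∀ {m} (π : Permutation′ (suc m)) → Unique (oneLine π)
oneLine-unique π = UniqueProps.tabulate⁺ (λ e → trans (sym (inverseʳ π)) (trans (cong (π ⟨$⟩ʳ_) (toℕ-injective e)) (inverseʳ π)))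

length-oneLine : ∀ {m} (π : Permutation′ (suc m)) → length (oneLine π) ≡ suc m
length-oneLine π = length-tabulate (λ k → toℕ (π ⟨$⟩ˡ k))

oneLine-bounded : ∀ {m} (π : Permutation′ (suc m)) → All (_< suc m) (oneLine π)
oneLine-bounded π = tabulate⁺ (λ k → toℕ<n (π ⟨$⟩ˡ k))

oneLine-↭ : ∀ {m} (π : Permutation′ (suc m)) → oneLine π ↭ interval 0 (suc m)
oneLine-↭ π with word-of-list _ (oneLine π) refl (oneLine-unique π) (oneLine-bounded π) (length-oneLine π)
... | w , e = subst (_↭ _) (sym e) (wordLine-↭ w)

oneLine-of-≈ : ∀ {m} (w : List (Fin m)) π → prod w ≈ π → oneLine π ≡ wordLine w
oneLine-of-≈ w π e = trans (sym (oneLine-cong (prod w) π e)) (oneLine-prod w)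

≈-of-oneLine : ∀ {m} (w : List (Fin m)) π → wordLine w ≡ oneLine π → prod w ≈ π
≈-of-oneLine w π e = oneLine-injective (prod w) π (trans (oneLine-prod w) e)

reducedWord : ∀ {m} (π : Permutation′ (suc m)) → Σ (List (Fin m)) λ r → IsReduced r π
reducedWord π with shortWord (oneLine π) (oneLine-↭ π)
... | r , line , length≡ = r , ≈-of-oneLine r π line , minimal
  where
  minimal : ∀ v → prod v ≈ π → length r ≤ length v
  minimal v e = subst (_≤ length v) (sym (trans length≡ (cong inversions (oneLine-of-≈ v π e)))) (inversions-wordLine≤length v)

reduced⇒ascending : ∀ {m} {r : List (Fin m)} {π} → IsReduced r π → Ascending r
reduced⇒ascending {r = r} {π} (prod≈ , minimal) with shortWord (wordLine r) (wordLine-↭ r)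
... | r′ , line , length≡ =
  ascending-of-length≤inversions r
    (subst (length r ≤_) length≡ (minimal r′ (λ k → trans (≈-of-oneLine r′ (prod r) (trans line (sym (oneLine-prod r))) k) (prod≈ k))))


-- The order isomorphism

code : ∀ {m} → Permutation′ (suc m) → List ℕ
code {m} π = shortLehmer m (oneLine π)

code-InC : ∀ {m} (π : Permutation′ (suc m)) → InC m (code π)
code-InC {m} π = shortLehmer-InC m (oneLine π) (length-oneLine π)

code≐lehmer : ∀ {m} (π : Permutation′ (suc m)) → code π ≐ lehmer (oneLine π)
code≐lehmer {m} π = shortLehmer≐lehmer m (oneLine π) (length-oneLine π)

code-injective : ∀ {m} (π σ : Permutation′ (suc m)) → code π ≡ code σ → π ≈ σ
code-injective π σ e = oneLine-injective π σ (lehmer-injective-↭interval (oneLine π) (oneLine σ) (oneLine-↭ π) (oneLine-↭ σ)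
  (≐-trans (≐-sym (code≐lehmer π)) (≐-trans (≡⇒≐ e) (code≐lehmer σ))))

InC⇒isCode : ∀ α → (∀ k → k < length α → get α k ≤ length α ∸ k) → IsCode (α ++ 0 ∷ [])
InC⇒isCode [] h = z≤n , tt
InC⇒isCode (a ∷ α) h = subst (a ≤_) (sym (trans (length-++ α) (+-comm (length α) 1))) (h 0 (s≤s z≤n)) ,
                  InC⇒isCode α (λ k p → h (suc k) (s≤s p))

code-surjective : ∀ {m} α → InC m α → ∃[ π ] (code {m} π ≡ α)
code-surjective {m} α (lα , bα) with realize-code {m} _ (α ++ 0 ∷ []) refl code-α0 (trans (length-++ α) (trans (+-comm (length α) 1) (cong suc lα)))
  where
  code-α0 : IsCode (α ++ 0 ∷ [])
  code-α0 = InC⇒isCode α (λ k p → subst (get α k ≤_) (cong (_∸ k) (sym lα)) (bα (suc k) (s≤s z≤n) (subst (suc k ≤_) lα p)))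
... | w , lehmer≡ , _ =
  prod w , trans (cong (shortLehmer m) (oneLine-prod w)) (trans (cong (take m) lehmer≡)
             (trans (cong (λ z → take z (α ++ 0 ∷ [])) (sym lα)) (take-++-length α (0 ∷ []))))

code-cong : ∀ {m} (π σ : Permutation′ (suc m)) → π ≈ σ → code π ≡ code σ
code-cong {m} π σ π≈σ = cong (shortLehmer m) (oneLine-cong π σ π≈σ)

code-prod : ∀ {m} (w : List (Fin m)) π → prod w ≈ π → shortLehmer m (wordLine w) ≡ code π
code-prod {m} w π e = cong (shortLehmer m) (sym (oneLine-of-≈ w π e))

≤B⇒≤A : ∀ {m} (u w : Permutation′ (suc m)) → u ≤B w → code u ≤A[ m ] code w
≤B⇒≤A {m} u w (r , reduced , v , v⊆r , prod≈u) =
  code-InC u , code-InC w ,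
  subst₂ (Star (CoverStep m)) (code-prod v u prod≈u) (code-prod r w (proj₁ reduced))
    (UpSwap*⇒CoverStep* (wordLine v) (wordLine r) (wordLine-↭ v)
      (wordLine-⊑⇒UpSwap* v r (subword⇒⊑ v r (reduced⇒ascending {π = w} reduced) v⊆r)))

≤A⇒≤B : ∀ {m} (u w : Permutation′ (suc m)) → code u ≤A[ m ] code w → u ≤B w
≤A⇒≤B {m} u w (_ , _ , chain) with reducedWord w
... | r , reduced with CoverStep*⇒subword r (code u) (code w) chain
                         (≐-trans (≡⇒≐ (cong lehmer (sym (oneLine-of-≈ r w (proj₁ reduced))))) (≐-sym (code≐lehmer w)))
... | v , v⊆r , e = r , reduced , v , v⊆r ,
  ≈-of-oneLine v u (lehmer-injective-↭interval (wordLine v) (oneLine u) (wordLine-↭ v) (oneLine-↭ u) (≐-trans e (code≐lehmer u)))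

corollary4p4 : ∀ (m : ℕ) →
    Σ (Permutation′ (suc m) → List ℕ) λ φ →
      (∀ π σ → π ≈ σ → φ π ≡ φ σ) ×
      (∀ π → InC m (φ π)) ×
      (∀ π σ → φ π ≡ φ σ → π ≈ σ) ×
      (∀ α → InC m α → ∃[ π ] (φ π ≡ α)) ×
      (∀ u w → (u ≤B w) ⇔ (φ u ≤A[ m ] φ w))
corollary4p4 m =
  code ,
  code-cong ,
  code-InC ,
  code-injective ,
  code-surjective ,
  (λ u w → mk⇔ (≤B⇒≤A u w) (≤A⇒≤B u w))
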